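{- Let $n\ge 5$ and let $\Gamma(G)$ be an unbalanced signed graph whose underlying graph $G$ belongs to $\Theta_n$. Then $\eta(\Gamma(G))\le n-4$.
   Context: A signed graph $\Gamma(G)=(G,\sigma)$ consists of a simple graph $G$ and a map $\sigma:E(G)\to\{+,-\}$; its adjacency matrix has entry $\sigma(v_iv_j)$ for edges and $0$ otherwise, and $\eta(\Gamma(G))$ is the multiplicity of $0$ as an eigenvalue. A cycle is positive if it has an even number of negative edges; $\Gamma(G)$ is balanced if all its cycles are positive, and unbalanced otherwise. A bicyclic graph is a connected simple graph with $|E|=|V|+1$. The graph $\Theta(p,q,l)$ is the union of three internally disjoint paths of lengths $p,q,l$ with common end vertices, where $p,q,l\ge1$ and at most one of them equals $1$. $\Theta_n$ is the set of bicyclic graphs on $n$ vertices obtained from some $\Theta(p,q,l)$ by (possibly) attaching trees to some of its vertices. -}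

module Defs where

open import Data.Nat using (ℕ; zero; suc; _+_; _*_; _≤_; _<_; _<ᵇ_; _%_)
open import Data.Fin using (Fin; zero; suc; toℕ; fromℕ; inject₁)
open import Data.Bool using (Bool; true; false; if_then_else_; _∧_)
open import Data.Rational using (ℚ; 0ℚ; 1ℚ; -_) renaming (_+_ to _+ℚ_; _*_ to _*ℚ_)
open import Data.Product using (Σ; _×_; ∃; _,_)
open import Relation.Binary.PropositionalEquality using (_≡_; _≢_)

Σℚ : ∀ {k} → (Fin k → ℚ) → ℚ
Σℚ {zero}  f = 0ℚ
Σℚ {suc k} f = f zero +ℚ Σℚ (λ i → f (suc i))

Σℕ : ∀ {k} → (Fin k → ℕ) → ℕ
Σℕ {zero}  f = 0
Σℕ {suc k} f = f zero + Σℕ (λ i → f (suc i))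

-- A signed graph on the vertex set Fin n: a simple graph (symmetric,
-- irreflexive adjacency) together with a sign on each edge
-- (neg u v = true means the edge uv is negative).
record SignedGraph (n : ℕ) : Set where
  field
    adj      : Fin n → Fin n → Bool
    adj-sym  : ∀ u v → adj u v ≡ adj v u
    adj-irr  : ∀ u → adj u u ≡ false
    neg      : Fin n → Fin n → Bool
    neg-sym  : ∀ u v → adj u v ≡ true → neg u v ≡ neg v u

open SignedGraph public

Adj : ∀ {n} → SignedGraph n → Fin n → Fin n → Set
Adj Γ u v = adj Γ u v ≡ true

adjMatrix : ∀ {n} → SignedGraph n → Fin n → Fin n → ℚ
adjMatrix Γ i j =
  if adj Γ i j then (if neg Γ i j then - 1ℚ else 1ℚ) else 0ℚ

mulVec : ∀ {n} → (Fin n → Fin n → ℚ) → (Fin n → ℚ) → Fin n → ℚ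
mulVec A x i = Σℚ (λ j → A i j *ℚ x j)

LinIndep : ∀ {n k} → (Fin k → Fin n → ℚ) → Set
LinIndep {n} {k} v =
  (c : Fin k → ℚ) → (∀ j → Σℚ (λ a → c a *ℚ v a j) ≡ 0ℚ) → ∀ a → c a ≡ 0ℚ

-- η(Γ) ≤ m : the null space of A(Γ) (the eigenspace of 0) has dimension
-- at most m, i.e. any linearly independent family of null vectors has
-- at most m members.
NullityAtMost : ∀ {n} → SignedGraph n → ℕ → Set
NullityAtMost {n} Γ m =
  (k : ℕ) (v : Fin k → Fin n → ℚ) →
  (∀ a → ∀ i → mulVec (adjMatrix Γ) (v a) i ≡ 0ℚ) →
  LinIndep v → k ≤ m

edgeCount : ∀ {n} → SignedGraph n → ℕ
edgeCount Γ = Σℕ (λ i → Σℕ (λ j →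
  if adj Γ i j ∧ (toℕ i <ᵇ toℕ j) then 1 else 0))

record Walk {n} (Γ : SignedGraph n) (k : ℕ) (u w : Fin n) : Set where
  field
    vtx   : Fin (suc k) → Fin n
    start : vtx zero ≡ u
    end   : vtx (fromℕ k) ≡ w
    step  : ∀ (i : Fin k) → Adj Γ (vtx (inject₁ i)) (vtx (suc i))

Connected : ∀ {n} → SignedGraph n → Set
Connected Γ = ∀ u w → ∃ λ k → Walk Γ k u w

Bicyclic : ∀ {n} → SignedGraph n → Set
Bicyclic {n} Γ = Connected Γ × edgeCount Γ ≡ suc n

record Path {n} (Γ : SignedGraph n) (k : ℕ) (u w : Fin n) : Set where
  field
    walk : Walk Γ k u w
    inj  : ∀ i j → Walk.vtx walk i ≡ Walk.vtx walk j → i ≡ j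
  vtx = Walk.vtx walk

Interior : ∀ {k} → Fin (suc k) → Set
Interior {k} i = 0 < toℕ i × toℕ i < k

AvoidsP : ∀ {n} {Γ : SignedGraph n} {k l u w} → Path Γ k u w → Path Γ l u w → Set
AvoidsP P Q = ∀ i j → Interior i → Path.vtx P i ≢ Path.vtx Q j

AtMostOneIsOne : ℕ → ℕ → ℕ → Set
AtMostOneIsOne p q l =
  (p ≡ 1 → q ≢ 1) × (p ≡ 1 → l ≢ 1) × (q ≡ 1 → l ≢ 1)

ContainsTheta : ∀ {n} → SignedGraph n → Set
ContainsTheta {n} Γ =
  Σ ℕ λ p → Σ ℕ λ q → Σ ℕ λ l → Σ (Fin n) λ u → Σ (Fin n) λ w →
  Σ (Path Γ p u w) λ P → Σ (Path Γ q u w) λ Q → Σ (Path Γ l u w) λ R →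
    1 ≤ p × 1 ≤ q × 1 ≤ l × AtMostOneIsOne p q l ×
    AvoidsP P Q × AvoidsP Q P × AvoidsP P R × AvoidsP R P ×
    AvoidsP Q R × AvoidsP R Q

-- G ∈ Θ_n : bicyclic graph on n vertices obtained from some Θ(p,q,l)
-- by attaching trees; equivalently a bicyclic graph containing Θ(p,q,l).
InThetaClass : ∀ {n} → SignedGraph n → Set
InThetaClass Γ = Bicyclic Γ × ContainsTheta Γ

record Cycle {n} (Γ : SignedGraph n) (k : ℕ) : Set where
  field
    vtx    : Fin (suc k) → Fin n
    len    : 3 ≤ k
    closed : vtx zero ≡ vtx (fromℕ k)
    step   : ∀ (i : Fin k) → Adj Γ (vtx (inject₁ i)) (vtx (suc i))
    inj    : ∀ (i j : Fin k) → vtx (inject₁ i) ≡ vtx (inject₁ j) → i ≡ j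

negCount : ∀ {n} {Γ : SignedGraph n} {k} → Cycle Γ k → ℕ
negCount {Γ = Γ} {k} C = Σℕ (λ (i : Fin k) →
  if neg Γ (Cycle.vtx C (inject₁ i)) (Cycle.vtx C (suc i)) then 1 else 0)

Unbalanced : ∀ {n} → SignedGraph n → Set
Unbalanced Γ = Σ ℕ λ k → Σ (Cycle Γ k) λ C → negCount C % 2 ≡ 1

{-# OPTIONS --safe #-}
-- A connected bicyclic graph has at most |S| + 1 edges inside any vertex set S, because each
-- vertex outside S needs its own edge towards S.  The theta Θ(p,q,l) has one edge more than
-- vertices, so it is an induced subgraph, and a vertex off the theta has at most one neighbour
-- on it.  Nullity at most n − 4 follows from four linearly independent columns of A(Γ), which
-- we exhibit as a 4 × 4 submatrix that is triangular with ±1 on the diagonal, or as the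
-- anti-diagonal 2 × 2 blocks of a negative square u a w b with u ≁ w and a ≁ b.
-- If a path of the theta has length at least 3, then P₂ P₁ u Q₁ is an induced path.  Otherwise
-- a vertex z off the theta gives an edge a y leaving the theta and a theta edge missing y.
-- If there is no such z, then n ≥ 5 forces Θ(2,2,2) = K₂,₃: unbalanced, it must contain a
-- negative square, for if the squares through P₁ are positive then a switching makes every
-- edge positive.
module Submission where

open import Defs
open import Data.Bool using (Bool; true; false; not; _∧_; _∨_; _xor_; if_then_else_; T)
import Data.Bool.Properties as Boolₚ
open import Data.Fin using (Fin; zero; suc; toℕ; fromℕ; inject₁; _≟_)
import Data.Fin.Properties as Finₚ
open import Data.List using (List; []; _∷_; length; tabulate; _++_; map)
import Data.List.Properties as Listₚ
open import Data.List.Membership.Propositional using (_∈_; _∉_)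
import Data.List.Membership.Propositional.Properties as ∈ₚ
open import Data.List.Relation.Unary.All as All using (All; []; _∷_)
import Data.List.Relation.Unary.All.Properties as Allₚ
open import Data.List.Relation.Unary.AllPairs as AllPairs using (AllPairs; []; _∷_)
import Data.List.Relation.Unary.AllPairs.Properties as AllPairsₚ
open import Data.List.Relation.Unary.Any as Any using (Any; here; there)
open import Data.List.Relation.Unary.Unique.Propositional using (Unique)
open import Data.Nat using (ℕ; zero; suc; _+_; _≤_; _<_; _∸_; _<ᵇ_; _%_; z≤n; s≤s)
open import Data.Nat.DivMod using (%-distribˡ-+)
import Data.Nat.Properties as ℕₚ
open import Data.Product using (Σ; _×_; ∃; ∃₂; _,_; proj₁; proj₂)
open import Data.Rational using (ℚ; 0ℚ; 1ℚ; -_; _-_; 1/_; ≢-nonZero)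
  renaming (_+_ to _+ℚ_; _*_ to _*ℚ_)
import Data.Rational.Properties as ℚₚ
open import Data.Rational.Solver using (module +-*-Solver)
open import Data.Sum using (_⊎_; inj₁; inj₂)
open import Function using (_∘_; Equivalence)
open import Relation.Binary.PropositionalEquality
  using (_≡_; _≢_; refl; sym; trans; cong; cong₂; subst; subst₂; module ≡-Reasoning)
open import Relation.Nullary using (¬_; Dec; yes; no; does; contradiction)
open import Relation.Nullary.Decidable
  using (dec-true; dec-false; decidable-stable; _×-dec_; _⊎-dec_; ¬?)
open import Algebra.Bundles using (CommutativeMonoid; CommutativeRing)
open import Algebra.Properties.CommutativeSemigroup ℕₚ.+-commutativeSemigroup
  using () renaming (interchange to +-interchange)
open import Algebra.Properties.CommutativeSemigroup
  (CommutativeMonoid.commutativeSemigroup ℚₚ.+-0-commutativeMonoid)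
  using () renaming (interchange to +ℚ-interchange)
open import Algebra.Properties.CommutativeSemigroup
  (CommutativeRing.+-commutativeSemigroup Boolₚ.xor-∧-commutativeRing)
  using () renaming (interchange to xor-interchange)

private
  variable
    n k : ℕ

Σℚ-cong : {f g : Fin k → ℚ} → (∀ i → f i ≡ g i) → Σℚ f ≡ Σℚ g
Σℚ-cong {zero}  f≗g = refl
Σℚ-cong {suc k} f≗g = cong₂ _+ℚ_ (f≗g zero) (Σℚ-cong (λ i → f≗g (suc i)))

Σℚ-zero : (f : Fin k → ℚ) → (∀ i → f i ≡ 0ℚ) → Σℚ f ≡ 0ℚ
Σℚ-zero {zero}  f f≗0 = refl
Σℚ-zero {suc k} f f≗0 = cong₂ _+ℚ_ (f≗0 zero) (Σℚ-zero _ (λ i → f≗0 (suc i)))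

Σℚ-+ : (f g : Fin k → ℚ) → Σℚ (λ i → f i +ℚ g i) ≡ Σℚ f +ℚ Σℚ g
Σℚ-+ {zero}  f g = refl
Σℚ-+ {suc k} f g = begin
  (f zero +ℚ g zero) +ℚ Σℚ (λ i → f (suc i) +ℚ g (suc i))
    ≡⟨ cong ((f zero +ℚ g zero) +ℚ_) (Σℚ-+ (λ i → f (suc i)) (λ i → g (suc i))) ⟩
  (f zero +ℚ g zero) +ℚ (Σℚ (λ i → f (suc i)) +ℚ Σℚ (λ i → g (suc i)))
    ≡⟨ +ℚ-interchange (f zero) (g zero) _ _ ⟩
  (f zero +ℚ Σℚ (λ i → f (suc i))) +ℚ (g zero +ℚ Σℚ (λ i → g (suc i))) ∎
  where open ≡-Reasoning

Σℚ-*ˡ : (c : ℚ) (f : Fin k → ℚ) → Σℚ (λ i → c *ℚ f i) ≡ c *ℚ Σℚ f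
Σℚ-*ˡ {zero}  c f = sym (ℚₚ.*-zeroʳ c)
Σℚ-*ˡ {suc k} c f = trans (cong (c *ℚ f zero +ℚ_) (Σℚ-*ˡ c (λ i → f (suc i))))
                          (sym (ℚₚ.*-distribˡ-+ c (f zero) _))

Σℚ-comm : ∀ {m} (f : Fin k → Fin m → ℚ) →
          Σℚ (λ i → Σℚ (λ j → f i j)) ≡ Σℚ (λ j → Σℚ (λ i → f i j))
Σℚ-comm {zero} {m} f = sym (Σℚ-zero {m} _ (λ _ → refl))
Σℚ-comm {suc k} f = begin
  Σℚ (λ j → f zero j) +ℚ Σℚ (λ i → Σℚ (λ j → f (suc i) j))
    ≡⟨ cong (Σℚ (λ j → f zero j) +ℚ_) (Σℚ-comm (λ i j → f (suc i) j)) ⟩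
  Σℚ (λ j → f zero j) +ℚ Σℚ (λ j → Σℚ (λ i → f (suc i) j))
    ≡⟨ Σℚ-+ (λ j → f zero j) (λ j → Σℚ (λ i → f (suc i) j)) ⟨
  Σℚ (λ j → f zero j +ℚ Σℚ (λ i → f (suc i) j)) ∎
  where open ≡-Reasoning

Σℚ-single : (f : Fin k → ℚ) (a : Fin k) → (∀ i → i ≢ a → f i ≡ 0ℚ) → Σℚ f ≡ f a
Σℚ-single {suc k} f zero f≗0 =
  trans (cong (f zero +ℚ_) (Σℚ-zero _ (λ i → f≗0 (suc i) λ ()))) (ℚₚ.+-identityʳ (f zero))
Σℚ-single {suc k} f (suc a) f≗0 = begin
  f zero +ℚ Σℚ (λ i → f (suc i)) ≡⟨ cong (_+ℚ Σℚ (λ i → f (suc i))) (f≗0 zero λ ()) ⟩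
  0ℚ +ℚ Σℚ (λ i → f (suc i))     ≡⟨ ℚₚ.+-identityˡ _ ⟩
  Σℚ (λ i → f (suc i))
    ≡⟨ Σℚ-single _ a (λ i i≢a → f≗0 (suc i) (i≢a ∘ Finₚ.suc-injective)) ⟩
  f (suc a)                      ∎
  where open ≡-Reasoning

Σℚ-pair : (f : Fin k → ℚ) (a b : Fin k) → a ≢ b →
          (∀ i → i ≢ a → i ≢ b → f i ≡ 0ℚ) → Σℚ f ≡ f a +ℚ f b
Σℚ-pair {suc k} f zero zero a≢b f≗0 = contradiction refl a≢b
Σℚ-pair {suc k} f zero (suc b) a≢b f≗0 =
  cong (f zero +ℚ_) (Σℚ-single _ b (λ i i≢b → f≗0 (suc i) (λ ()) (i≢b ∘ Finₚ.suc-injective)))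
Σℚ-pair {suc k} f (suc a) zero a≢b f≗0 = trans
  (cong (f zero +ℚ_) (Σℚ-single _ a (λ i i≢a → f≗0 (suc i) (i≢a ∘ Finₚ.suc-injective) λ ())))
  (ℚₚ.+-comm (f zero) (f (suc a)))
Σℚ-pair {suc k} f (suc a) (suc b) a≢b f≗0 = begin
  f zero +ℚ Σℚ (λ i → f (suc i))
    ≡⟨ cong (_+ℚ Σℚ (λ i → f (suc i))) (f≗0 zero (λ ()) (λ ())) ⟩
  0ℚ +ℚ Σℚ (λ i → f (suc i))
    ≡⟨ ℚₚ.+-identityˡ _ ⟩
  Σℚ (λ i → f (suc i))
    ≡⟨ Σℚ-pair _ a b (a≢b ∘ cong suc)
         (λ i i≢a i≢b → f≗0 (suc i) (i≢a ∘ Finₚ.suc-injective) (i≢b ∘ Finₚ.suc-injective)) ⟩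
  f (suc a) +ℚ f (suc b) ∎
  where open ≡-Reasoning

Σℕ-cong : {f g : Fin k → ℕ} → (∀ i → f i ≡ g i) → Σℕ f ≡ Σℕ g
Σℕ-cong {zero}  f≗g = refl
Σℕ-cong {suc k} f≗g = cong₂ _+_ (f≗g zero) (Σℕ-cong (λ i → f≗g (suc i)))

Σℕ-mono : {f g : Fin k → ℕ} → (∀ i → f i ≤ g i) → Σℕ f ≤ Σℕ g
Σℕ-mono {zero}  f≤g = z≤n
Σℕ-mono {suc k} f≤g = ℕₚ.+-mono-≤ (f≤g zero) (Σℕ-mono (λ i → f≤g (suc i)))

Σℕ-+ : (f g : Fin k → ℕ) → Σℕ (λ i → f i + g i) ≡ Σℕ f + Σℕ g
Σℕ-+ {zero}  f g = refl
Σℕ-+ {suc k} f g = begin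
  (f zero + g zero) + Σℕ (λ i → f (suc i) + g (suc i))
    ≡⟨ cong (f zero + g zero +_) (Σℕ-+ (λ i → f (suc i)) (λ i → g (suc i))) ⟩
  (f zero + g zero) + (Σℕ (λ i → f (suc i)) + Σℕ (λ i → g (suc i)))
    ≡⟨ +-interchange (f zero) (g zero) _ _ ⟩
  (f zero + Σℕ (λ i → f (suc i))) + (g zero + Σℕ (λ i → g (suc i))) ∎
  where open ≡-Reasoning

Σℕ-bump : (f g : Fin k → ℕ) (a : Fin k) → f a ≡ suc (g a) →
          (∀ i → i ≢ a → f i ≡ g i) → Σℕ f ≡ suc (Σℕ g)
Σℕ-bump {suc k} f g zero    fa f≗g = cong₂ _+_ fa (Σℕ-cong (λ i → f≗g (suc i) λ ()))
Σℕ-bump {suc k} f g (suc a) fa f≗g = trans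
  (cong₂ _+_ (f≗g zero λ ())
             (Σℕ-bump _ _ a fa (λ i i≢a → f≗g (suc i) (i≢a ∘ Finₚ.suc-injective))))
  (ℕₚ.+-suc (g zero) _)

Σℕ-zero : (f : Fin k → ℕ) → (∀ i → f i ≡ 0) → Σℕ f ≡ 0
Σℕ-zero {zero}  f f≗0 = refl
Σℕ-zero {suc k} f f≗0 = cong₂ _+_ (f≗0 zero) (Σℕ-zero _ (λ i → f≗0 (suc i)))

ind : Bool → ℕ
ind b = if b then 1 else 0

count : (Fin n → Bool) → ℕ
count D = Σℕ (λ j → ind (D j))

⁅_⁆ : Fin n → Fin n → Bool
⁅ a ⁆ j = does (j ≟ a)

_∪_ : (Fin n → Bool) → (Fin n → Bool) → Fin n → Bool
(D ∪ E) j = D j ∨ E j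

∁ : (Fin n → Bool) → Fin n → Bool
∁ D j = not (D j)

_─_ : (Fin n → Bool) → Fin n → Fin n → Bool
(D ─ a) j = D j ∧ not (does (j ≟ a))

⁅⁆-self : (a : Fin n) → ⁅ a ⁆ a ≡ true
⁅⁆-self a = dec-true (a ≟ a) refl

∪-introˡ : (D E : Fin n → Bool) {j : Fin n} → D j ≡ true → (D ∪ E) j ≡ true
∪-introˡ D E Dj rewrite Dj = refl

∪-introʳ : (D E : Fin n → Bool) {j : Fin n} → E j ≡ true → (D ∪ E) j ≡ true
∪-introʳ D E {j} Ej rewrite Ej = Boolₚ.∨-zeroʳ (D j)

─-intro : (D : Fin n → Bool) {a j : Fin n} → D j ≡ true → j ≢ a → (D ─ a) j ≡ true
─-intro D {a} {j} Dj j≢a rewrite Dj | dec-false (j ≟ a) j≢a = refl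

fromList : List (Fin n) → Fin n → Bool
fromList []       j = false
fromList (c ∷ cs) j = (⁅ c ⁆ ∪ fromList cs) j

count-⁅⁆ : (a : Fin n) → count ⁅ a ⁆ ≡ 1
count-⁅⁆ {suc n} zero    = cong suc (Σℕ-zero {n} _ (λ _ → refl))
count-⁅⁆ {suc n} (suc a) = count-⁅⁆ a

count-remove : (D : Fin n → Bool) {a : Fin n} → D a ≡ true → count D ≡ suc (count (D ─ a))
count-remove D {a} Da = Σℕ-bump _ _ a at-a off-a
  where
  at-a : ind (D a) ≡ suc (ind (D a ∧ not (does (a ≟ a))))
  at-a rewrite Da | dec-true (a ≟ a) refl = refl
  off-a : ∀ j → j ≢ a → ind (D j) ≡ ind (D j ∧ not (does (j ≟ a)))
  off-a j j≢a rewrite dec-false (j ≟ a) j≢a | Boolₚ.∧-identityʳ (D j) = refl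

count-∪ : (D E : Fin n → Bool) → count (D ∪ E) ≤ count D + count E
count-∪ D E = ℕₚ.≤-trans (Σℕ-mono (λ j → ind-∨ (D j) (E j)))
                          (ℕₚ.≤-reflexive (Σℕ-+ (λ j → ind (D j)) (λ j → ind (E j))))
  where
  ind-∨ : ∀ b c → ind (b ∨ c) ≤ ind b + ind c
  ind-∨ true  c = s≤s z≤n
  ind-∨ false c = ℕₚ.≤-refl

count-∁ : (D : Fin n → Bool) → count D + count (∁ D) ≡ n
count-∁ {n} D = begin
  count D + count (∁ D)                   ≡⟨ Σℕ-+ (λ j → ind (D j)) (λ j → ind (not (D j))) ⟨
  Σℕ (λ j → ind (D j) + ind (not (D j)))  ≡⟨ Σℕ-cong (λ j → ind+ind-not (D j)) ⟩
  Σℕ {n} (λ _ → 1)                        ≡⟨ Σℕ-one n ⟩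
  n                                       ∎
  where
  open ≡-Reasoning
  ind+ind-not : ∀ b → ind b + ind (not b) ≡ 1
  ind+ind-not true  = refl
  ind+ind-not false = refl
  Σℕ-one : ∀ k → Σℕ {k} (λ _ → 1) ≡ k
  Σℕ-one zero    = refl
  Σℕ-one (suc k) = cong suc (Σℕ-one k)

count-∁-∪⁅⁆ : (S : Fin n → Bool) {a : Fin n} {m : ℕ} → S a ≡ false →
              count (∁ S) ≡ suc m → count (∁ (S ∪ ⁅ a ⁆)) ≡ m
count-∁-∪⁅⁆ S {a} Sa #∁S = trans (Σℕ-cong (λ j → cong ind (not-∨ (S j) _)))
  (ℕₚ.suc-injective (trans (sym (count-remove (∁ S) (cong not Sa))) #∁S))
  where
  not-∨ : ∀ x y → not (x ∨ y) ≡ not x ∧ not y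
  not-∨ true  y = refl
  not-∨ false y = refl

count-full : (D : Fin n → Bool) → (∀ j → D j ≡ true) → count D ≡ n
count-full D full = trans (sym (ℕₚ.+-identityʳ (count D)))
  (trans (cong (count D +_) (sym (Σℕ-zero _ (λ j → cong (ind ∘ not) (full j))))) (count-∁ D))

count-suc⇒∃ : (D : Fin n → Bool) {m : ℕ} → count D ≡ suc m → ∃ λ j → D j ≡ true
count-suc⇒∃ {suc n} D eq with D zero in D0
... | true  = zero , D0
... | false = let j , Dj = count-suc⇒∃ (λ j → D (suc j)) eq in suc j , Dj

∈⇒fromList : {cs : List (Fin n)} {j : Fin n} → j ∈ cs → fromList cs j ≡ true
∈⇒fromList {cs = c ∷ cs} (here refl) = ∪-introˡ ⁅ c ⁆ (fromList cs) (⁅⁆-self c)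
∈⇒fromList {cs = c ∷ cs} (there j∈cs) = ∪-introʳ ⁅ c ⁆ (fromList cs) (∈⇒fromList j∈cs)

fromList⇒∈ : {cs : List (Fin n)} {j : Fin n} → fromList cs j ≡ true → j ∈ cs
fromList⇒∈ {cs = c ∷ cs} {j} eq with j ≟ c
... | yes refl = here refl
... | no  _    = there (fromList⇒∈ eq)

count-fromList≤ : (cs : List (Fin n)) → count (fromList cs) ≤ length cs
count-fromList≤ {n} []   = ℕₚ.≤-reflexive (Σℕ-zero {n} _ (λ _ → refl))
count-fromList≤ (c ∷ cs) = begin
  count (⁅ c ⁆ ∪ fromList cs)         ≤⟨ count-∪ ⁅ c ⁆ (fromList cs) ⟩
  count ⁅ c ⁆ + count (fromList cs)   ≡⟨ cong (_+ count (fromList cs)) (count-⁅⁆ c) ⟩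
  suc (count (fromList cs))           ≤⟨ s≤s (count-fromList≤ cs) ⟩
  suc (length cs)                     ∎
  where open ℕₚ.≤-Reasoning

length≤count : (D : Fin n → Bool) {L : List (Fin n)} → Unique L → All (λ j → D j ≡ true) L →
               length L ≤ count D
length≤count D []                []         = z≤n
length≤count D {a ∷ L} (a∉L ∷ uL) (Da ∷ DL) = subst (suc (length L) ≤_) (sym (count-remove D Da))
  (s≤s (length≤count (D ─ a) uL (All.zipWith (λ (a≢j , Dj) → ─-intro D Dj (a≢j ∘ sym))
                                             (a∉L , DL))))

count₂ : (Fin n → Fin n → Bool) → ℕ
count₂ G = Σℕ (λ i → count (G i))

_─₂_ : (Fin n → Fin n → Bool) → Fin n × Fin n → Fin n → Fin n → Bool
(G ─₂ (a , b)) i = if does (i ≟ a) then G i ─ b else G i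

count₂-remove : (G : Fin n → Fin n → Bool) {a b : Fin n} → G a b ≡ true →
                count₂ G ≡ suc (count₂ (G ─₂ (a , b)))
count₂-remove G {a} {b} Gab = Σℕ-bump _ _ a at-a off-a
  where
  at-a : count (G a) ≡ suc (count ((G ─₂ (a , b)) a))
  at-a rewrite dec-true (a ≟ a) refl = count-remove (G a) Gab
  off-a : ∀ i → i ≢ a → count (G i) ≡ count ((G ─₂ (a , b)) i)
  off-a i i≢a rewrite dec-false (i ≟ a) i≢a = refl

length≤count₂ : (G : Fin n → Fin n → Bool) {L : List (Fin n × Fin n)} → Unique L →
                All (λ (i , j) → G i j ≡ true) L → length L ≤ count₂ G
length≤count₂ G []                []          = z≤n
length≤count₂ G {(a , b) ∷ L} (ab∉L ∷ uL) (Gab ∷ GL) =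
  subst (suc (length L) ≤_) (sym (count₂-remove G Gab))
    (s≤s (length≤count₂ (G ─₂ (a , b)) uL (All.zipWith still-in (ab∉L , GL))))
  where
  still-in : ∀ {ij} → (a , b) ≢ ij × G (proj₁ ij) (proj₂ ij) ≡ true →
             (G ─₂ (a , b)) (proj₁ ij) (proj₂ ij) ≡ true
  still-in {i , j} (ab≢ij , Gij) with i ≟ a
  ... | no  _    = Gij
  ... | yes refl = ─-intro (G a) Gij (λ j≡b → ab≢ij (cong (a ,_) (sym j≡b)))

Edge : ℕ → Set
Edge n = Fin n × Fin n

_≈ᴱ_ : Edge n → Edge n → Set
(a , b) ≈ᴱ (c , d) = (a ≡ c × b ≡ d) ⊎ (a ≡ d × b ≡ c)

_≉ᴱ_ : Edge n → Edge n → Set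
e ≉ᴱ f = ¬ (e ≈ᴱ f)

_≈ᴱ?_ : (e f : Edge n) → Dec (e ≈ᴱ f)
(a , b) ≈ᴱ? (c , d) = ((a ≟ c) ×-dec (b ≟ d)) ⊎-dec ((a ≟ d) ×-dec (b ≟ c))

IsEdge : SignedGraph n → Edge n → Set
IsEdge Γ (a , b) = Adj Γ a b

Within : (Fin n → Bool) → Edge n → Set
Within S (a , b) = S a ≡ true × S b ≡ true

adj-irrefl : (Γ : SignedGraph n) {a b : Fin n} → Adj Γ a b → a ≢ b
adj-irrefl Γ {a} ab refl with () ← trans (sym ab) (adj-irr Γ a)

nonAdj-≢ : (Γ : SignedGraph n) {a b c : Fin n} → adj Γ a b ≡ false → Adj Γ a c → c ≢ b
nonAdj-≢ Γ a≁b ac refl with () ← trans (sym ac) a≁b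

Adj-sym : (Γ : SignedGraph n) {x y : Fin n} → Adj Γ x y → Adj Γ y x
Adj-sym Γ {x} {y} xy = trans (adj-sym Γ y x) xy

nonAdj-sym : (Γ : SignedGraph n) {x y : Fin n} → adj Γ x y ≡ false → adj Γ y x ≡ false
nonAdj-sym Γ {x} {y} x≁y = trans (adj-sym Γ y x) x≁y

outside-≉-within : (S : Fin n → Bool) {a : Fin n} → S a ≡ false → {L : List (Edge n)} →
                   All (Within S) L → {c : Fin n} → All ((a , c) ≉ᴱ_) L
outside-≉-within S {a} Sa within = All.map
  (λ { (Sx , Sy) (inj₁ (a≡x , _)) → a≢inside Sx a≡x
     ; (Sx , Sy) (inj₂ (a≡y , _)) → a≢inside Sy a≡y })
  within
  where
  a≢inside : ∀ {x} → S x ≡ true → a ≢ x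
  a≢inside Sx refl with () ← trans (sym Sa) Sx

ordered : Edge n → Edge n
ordered (a , b) = if toℕ a <ᵇ toℕ b then (a , b) else (b , a)

ordered-≈ᴱ : (e : Edge n) → ordered e ≈ᴱ e
ordered-≈ᴱ (a , b) with toℕ a <ᵇ toℕ b
... | true  = inj₁ (refl , refl)
... | false = inj₂ (refl , refl)

≈ᴱ-trans : {e f g : Edge n} → e ≈ᴱ f → f ≈ᴱ g → e ≈ᴱ g
≈ᴱ-trans (inj₁ (refl , refl)) f≈g                  = f≈g
≈ᴱ-trans (inj₂ (refl , refl)) (inj₁ (refl , refl)) = inj₂ (refl , refl)
≈ᴱ-trans (inj₂ (refl , refl)) (inj₂ (refl , refl)) = inj₁ (refl , refl)

≈ᴱ-sym : {e f : Edge n} → e ≈ᴱ f → f ≈ᴱ e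
≈ᴱ-sym (inj₁ (refl , refl)) = inj₁ (refl , refl)
≈ᴱ-sym (inj₂ (refl , refl)) = inj₂ (refl , refl)

ordered-injective : {e f : Edge n} → ordered e ≡ ordered f → e ≈ᴱ f
ordered-injective {e = e} {f} eq =
  ≈ᴱ-trans (≈ᴱ-sym (ordered-≈ᴱ e)) (subst (_≈ᴱ f) (sym eq) (ordered-≈ᴱ f))

ordered-counted : (Γ : SignedGraph n) (e : Edge n) → IsEdge Γ e →
                  adj Γ (proj₁ (ordered e)) (proj₂ (ordered e)) ∧
                    (toℕ (proj₁ (ordered e)) <ᵇ toℕ (proj₂ (ordered e))) ≡ true
ordered-counted Γ (a , b) ab with toℕ a <ᵇ toℕ b in a<ᵇb
... | true  rewrite ab | a<ᵇb = refl
... | false rewrite trans (adj-sym Γ b a) ab = Equivalence.to Boolₚ.T-≡ (ℕₚ.<⇒<ᵇ b<a)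
  where
  b<a : toℕ b < toℕ a
  b<a = ℕₚ.≤∧≢⇒< (ℕₚ.≮⇒≥ (λ a<b → subst T a<ᵇb (ℕₚ.<⇒<ᵇ a<b)))
                  (λ b≡a → adj-irrefl Γ ab (sym (Finₚ.toℕ-injective b≡a)))

distinctEdges≤edgeCount : (Γ : SignedGraph n) {L : List (Edge n)} →
  AllPairs _≉ᴱ_ L → All (IsEdge Γ) L → length L ≤ edgeCount Γ
distinctEdges≤edgeCount Γ {L} distinct edges = subst (_≤ edgeCount Γ) (Listₚ.length-map ordered L)
  (length≤count₂ (λ i j → adj Γ i j ∧ (toℕ i <ᵇ toℕ j))
    (AllPairsₚ.map⁺ (AllPairs.map (λ e≉f eq → e≉f (ordered-injective eq)) distinct))
    (Allₚ.map⁺ (All.map (ordered-counted Γ _) edges)))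

crossing : (f : Fin (suc k) → Bool) → f zero ≡ false → f (fromℕ k) ≡ true →
           ∃ λ (i : Fin k) → f (inject₁ i) ≡ false × f (suc i) ≡ true
crossing {zero}  f f0 fk with () ← trans (sym f0) fk
crossing {suc k} f f0 fk with f (suc zero) in f1
... | true  = zero , f0 , f1
... | false = let i , fi , fsi = crossing (λ i → f (suc i)) f1 fk in suc i , fi , fsi

exitEdge : {Γ : SignedGraph n} (S : Fin n → Bool) {z u : Fin n} → Walk Γ k z u →
           S z ≡ false → S u ≡ true → ∃₂ λ a b → Adj Γ a b × S a ≡ false × S b ≡ true
exitEdge S W Sz Su =
  let i , Sa , Sb = crossing (λ i → S (Walk.vtx W i)) (trans (cong S (Walk.start W)) Sz)
                                                       (trans (cong S (Walk.end W)) Su)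
  in _ , _ , Walk.step W i , Sa , Sb

-- Induction on the vertices outside S: a walk from one of them to u leaves the complement of S
-- along an edge that is new, and its outer end can be added to S.
module _ {Γ : SignedGraph n} (connected : Connected Γ) {u : Fin n} where

  edgesWithin+count∁≤edgeCount : (S : Fin n → Bool) → S u ≡ true → {L : List (Edge n)} →
    AllPairs _≉ᴱ_ L → All (IsEdge Γ) L → All (Within S) L →
    length L + count (∁ S) ≤ edgeCount Γ
  edgesWithin+count∁≤edgeCount S Su = go (count (∁ S)) S Su refl
    where
    go : ∀ m S → S u ≡ true → count (∁ S) ≡ m → {L : List (Edge n)} →
         AllPairs _≉ᴱ_ L → All (IsEdge Γ) L → All (Within S) L → length L + m ≤ edgeCount Γ
    go zero    S Su _ {L} distinct edges _ = subst (_≤ edgeCount Γ) (sym (ℕₚ.+-identityʳ (length L)))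
                                                  (distinctEdges≤edgeCount Γ distinct edges)
    go (suc m) S Su #∁S {L} distinct edges within =
      let z , ∁Sz = count-suc⇒∃ (∁ S) #∁S
          a , b , ab , Sa , Sb = exitEdge S (proj₂ (connected z u)) (Boolₚ.not-injective ∁Sz) Su
          grow = ∪-introˡ S ⁅ a ⁆
      in subst (_≤ edgeCount Γ) (sym (ℕₚ.+-suc (length L) m))
           (go m (S ∪ ⁅ a ⁆) (grow Su) (count-∁-∪⁅⁆ S Sa #∁S)
               (outside-≉-within S Sa within ∷ distinct) (ab ∷ edges)
               ((∪-introʳ S ⁅ a ⁆ (⁅⁆-self a) , grow Sb)
                 ∷ All.map (λ (Sx , Sy) → grow Sx , grow Sy) within))

edgesWithin≤suc-count : {Γ : SignedGraph n} → Bicyclic Γ → (S : Fin n → Bool) {u : Fin n} →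
  S u ≡ true → {L : List (Edge n)} → AllPairs _≉ᴱ_ L → All (IsEdge Γ) L → All (Within S) L →
  length L ≤ suc (count S)
edgesWithin≤suc-count {n} {Γ} (connected , #E) S Su {L} distinct edges within =
  ℕₚ.+-cancelʳ-≤ (count (∁ S)) (length L) (suc (count S)) (begin
    length L + count (∁ S)        ≤⟨ edgesWithin+count∁≤edgeCount connected S Su
                                                                  distinct edges within ⟩
    edgeCount Γ                   ≡⟨ #E ⟩
    suc n                         ≡⟨ cong suc (count-∁ S) ⟨
    suc (count S + count (∁ S))   ∎)
  where open ℕₚ.≤-Reasoning

-- With |T| > |S| the bound of edgesWithin≤suc-count is attained, so there is no room for any
-- further edge inside S or for a second edge from an outside vertex into S.
module Tight {Γ : SignedGraph n} (bicyclic : Bicyclic Γ) (S : Fin n → Bool) {u : Fin n}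
  (Su : S u ≡ true) {T : List (Edge n)} (T-distinct : AllPairs _≉ᴱ_ T) (T-edges : All (IsEdge Γ) T)
  (T-within : All (Within S) T) (T-tight : suc (count S) ≤ length T) where

  extraEdges≤ : (S′ : Fin n → Bool) → (∀ {x} → S x ≡ true → S′ x ≡ true) → (r : ℕ) →
    count S′ ≤ count S + r → {X : List (Edge n)} → AllPairs _≉ᴱ_ X → All (IsEdge Γ) X →
    All (λ e → All (e ≉ᴱ_) T) X → All (Within S′) X → length X ≤ r
  extraEdges≤ S′ S⊆S′ r #S′ {X} X-distinct X-edges X∉T X-within =
    ℕₚ.+-cancelʳ-≤ (length T) (length X) r (begin
      length X + length T     ≡⟨ Listₚ.length-++ X ⟨
      length (X ++ T)         ≤⟨ edgesWithin≤suc-count bicyclic S′ (S⊆S′ Su)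
                                   (AllPairsₚ.++⁺ X-distinct T-distinct X∉T)
                                   (Allₚ.++⁺ X-edges T-edges)
                                   (Allₚ.++⁺ X-within
                                     (All.map (λ (Sx , Sy) → S⊆S′ Sx , S⊆S′ Sy) T-within)) ⟩
      suc (count S′)          ≤⟨ s≤s #S′ ⟩
      suc (count S) + r       ≤⟨ ℕₚ.+-monoˡ-≤ r T-tight ⟩
      length T + r            ≡⟨ ℕₚ.+-comm (length T) r ⟩
      r + length T            ∎)
    where open ℕₚ.≤-Reasoning

  noChord : {x y : Fin n} → S x ≡ true → S y ≡ true → All ((x , y) ≉ᴱ_) T →
            adj Γ x y ≡ false
  noChord Sx Sy xy∉T = Boolₚ.¬-not λ xy → ℕₚ.1+n≰n
    (extraEdges≤ S (λ Sz → Sz) 0 (ℕₚ.≤-reflexive (sym (ℕₚ.+-identityʳ _)))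
                 ([] ∷ []) (xy ∷ []) (xy∉T ∷ []) ((Sx , Sy) ∷ []))

  edgeWithin⇒inT : {x y : Fin n} → S x ≡ true → S y ≡ true → Adj Γ x y →
                   Any ((x , y) ≈ᴱ_) T
  edgeWithin⇒inT {x} {y} Sx Sy xy with Any.any? ((x , y) ≈ᴱ?_) T
  ... | yes xy∈T = xy∈T
  ... | no  xy∉T = contradiction (trans (sym xy) (noChord Sx Sy (Allₚ.¬Any⇒All¬ T xy∉T))) λ ()

  noSecondNeighbour : {a y b : Fin n} → S a ≡ false → Adj Γ a y → S y ≡ true → S b ≡ true →
                      b ≢ y → adj Γ a b ≡ false
  noSecondNeighbour {a} {y} {b} Sa ay Sy Sb b≢y = Boolₚ.¬-not λ ab → ℕₚ.1+n≰n
    (extraEdges≤ (S ∪ ⁅ a ⁆) (∪-introˡ S ⁅ a ⁆) 1 #S′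
                 ((ab≉ay ∷ []) ∷ [] ∷ []) (ab ∷ ay ∷ [])
                 (outside-≉-within S Sa T-within ∷ outside-≉-within S Sa T-within ∷ [])
                 ((Sa′ , ∪-introˡ S ⁅ a ⁆ Sb) ∷ (Sa′ , ∪-introˡ S ⁅ a ⁆ Sy) ∷ []))
    where
    Sa′ = ∪-introʳ S ⁅ a ⁆ (⁅⁆-self a)
    #S′ : count (S ∪ ⁅ a ⁆) ≤ count S + 1
    #S′ = subst (count (S ∪ ⁅ a ⁆) ≤_) (cong (count S +_) (count-⁅⁆ a)) (count-∪ S ⁅ a ⁆)
    ab≉ay : (a , b) ≉ᴱ (a , y)
    ab≉ay (inj₁ (_ , b≡y))      = b≢y b≡y
    ab≉ay (inj₂ (a≡y , b≡a))    = b≢y (trans b≡a a≡y)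

*-cancel-nonzeroˡ : (a : ℚ) {x : ℚ} → a ≢ 0ℚ → a *ℚ x ≡ 0ℚ → x ≡ 0ℚ
*-cancel-nonzeroˡ a {x} a≢0 ax≡0 = begin
  x                       ≡⟨ ℚₚ.*-identityˡ x ⟨
  1ℚ *ℚ x                 ≡⟨ cong (_*ℚ x) (ℚₚ.*-inverseˡ a {{≢-nonZero a≢0}}) ⟨
  (a⁻¹ *ℚ a) *ℚ x         ≡⟨ ℚₚ.*-assoc a⁻¹ a x ⟩
  a⁻¹ *ℚ (a *ℚ x)         ≡⟨ cong (a⁻¹ *ℚ_) ax≡0 ⟩
  a⁻¹ *ℚ 0ℚ               ≡⟨ ℚₚ.*-zeroʳ a⁻¹ ⟩
  0ℚ                      ∎
  where
  open ≡-Reasoning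
  a⁻¹ = (1/ a) {{≢-nonZero a≢0}}

IndependentOn : (Fin n → Bool) → (Fin k → Fin n → ℚ) → Set
IndependentOn {k = k} E v = (c : Fin k → ℚ) →
  (∀ j → E j ≡ true → Σℚ (λ a → c a *ℚ v a j) ≡ 0ℚ) → ∀ a → c a ≡ 0ℚ

module _ (v : Fin (suc k) → Fin n → ℚ) (j₀ : Fin n) (pivot≢0 : v zero j₀ ≢ 0ℚ) where

  private
    pivot⁻¹ : ℚ
    pivot⁻¹ = (1/ v zero j₀) {{≢-nonZero pivot≢0}}

    ratio : Fin k → ℚ
    ratio b = v (suc b) j₀ *ℚ pivot⁻¹

    ratio-pivot : ∀ b → ratio b *ℚ v zero j₀ ≡ v (suc b) j₀
    ratio-pivot b = begin
      (v (suc b) j₀ *ℚ pivot⁻¹) *ℚ v zero j₀ ≡⟨ ℚₚ.*-assoc (v (suc b) j₀) pivot⁻¹ (v zero j₀) ⟩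
      v (suc b) j₀ *ℚ (pivot⁻¹ *ℚ v zero j₀)
        ≡⟨ cong (v (suc b) j₀ *ℚ_) (ℚₚ.*-inverseˡ (v zero j₀) {{≢-nonZero pivot≢0}}) ⟩
      v (suc b) j₀ *ℚ 1ℚ                     ≡⟨ ℚₚ.*-identityʳ (v (suc b) j₀) ⟩
      v (suc b) j₀                           ∎
      where open ≡-Reasoning

  eliminate : Fin k → Fin n → ℚ
  eliminate b j = v (suc b) j - ratio b *ℚ v zero j

  eliminate-pivot : ∀ b → eliminate b j₀ ≡ 0ℚ
  eliminate-pivot b =
    trans (cong (λ t → v (suc b) j₀ - t) (ratio-pivot b)) (ℚₚ.+-inverseʳ (v (suc b) j₀))

  -- The new coefficient of v zero undoes the subtractions performed by eliminate.
  liftCoefficients : (Fin k → ℚ) → Fin (suc k) → ℚ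
  liftCoefficients c′ zero    = Σℚ (λ b → - (c′ b *ℚ ratio b))
  liftCoefficients c′ (suc b) = c′ b

  eliminate-combination : (c′ : Fin k → ℚ) (j : Fin n) →
    Σℚ (λ a → liftCoefficients c′ a *ℚ v a j) ≡ Σℚ (λ b → c′ b *ℚ eliminate b j)
  eliminate-combination c′ j = begin
    Σℚ t *ℚ v zero j +ℚ Σℚ (λ b → c′ b *ℚ v (suc b) j)
      ≡⟨ cong (_+ℚ Σℚ (λ b → c′ b *ℚ v (suc b) j))
              (trans (ℚₚ.*-comm (Σℚ t) (v zero j)) (sym (Σℚ-*ˡ (v zero j) t))) ⟩
    Σℚ (λ b → v zero j *ℚ t b) +ℚ Σℚ (λ b → c′ b *ℚ v (suc b) j)
      ≡⟨ Σℚ-+ (λ b → v zero j *ℚ t b) (λ b → c′ b *ℚ v (suc b) j) ⟨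
    Σℚ (λ b → v zero j *ℚ t b +ℚ c′ b *ℚ v (suc b) j)
      ≡⟨ Σℚ-cong (λ b → distribute (c′ b) (v (suc b) j) (ratio b) (v zero j)) ⟩
    Σℚ (λ b → c′ b *ℚ eliminate b j) ∎
    where
    open ≡-Reasoning
    open +-*-Solver
    t : Fin k → ℚ
    t b = - (c′ b *ℚ ratio b)
    distribute : ∀ γ x ρ y → y *ℚ (- (γ *ℚ ρ)) +ℚ γ *ℚ x ≡ γ *ℚ (x - ρ *ℚ y)
    distribute = solve 4 (λ γ x ρ y → y :* (:- (γ :* ρ)) :+ γ :* x := γ :* (x :- ρ :* y)) refl

  eliminate-independentOn : {E : Fin n → Bool} → E j₀ ≡ true → IndependentOn E v →
                            IndependentOn (E ─ j₀) eliminate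
  eliminate-independentOn {E} Ej₀ indep c′ vanish b = indep (liftCoefficients c′) vanish′ (suc b)
    where
    vanish′ : ∀ j → E j ≡ true → Σℚ (λ a → liftCoefficients c′ a *ℚ v a j) ≡ 0ℚ
    vanish′ j Ej with j ≟ j₀
    ... | yes refl = trans (eliminate-combination c′ j₀) (Σℚ-zero _ λ b →
                       trans (cong (c′ b *ℚ_) (eliminate-pivot b)) (ℚₚ.*-zeroʳ (c′ b)))
    ... | no j≢j₀  = trans (eliminate-combination c′ j) (vanish j (─-intro E Ej j≢j₀))

independentOn⇒≤count : (E : Fin n → Bool) (v : Fin k → Fin n → ℚ) → IndependentOn E v →
                        k ≤ count E
independentOn⇒≤count {k = zero}  E v indep = z≤n
independentOn⇒≤count {k = suc k} E v indep
  with Finₚ.any? (λ j → (E j Boolₚ.≟ true) ×-dec ¬? (v zero j ℚₚ.≟ 0ℚ))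
... | yes (j₀ , Ej₀ , pivot≢0) = subst (suc k ≤_) (sym (count-remove E Ej₀))
  (s≤s (independentOn⇒≤count (E ─ j₀) (eliminate v j₀ pivot≢0)
                              (eliminate-independentOn v j₀ pivot≢0 Ej₀ indep)))
... | no no-pivot = contradiction (indep unit v₀-vanishes zero) ℚₚ.1≢0
  where
  unit : Fin (suc k) → ℚ
  unit zero    = 1ℚ
  unit (suc _) = 0ℚ
  v₀-vanishes : ∀ j → E j ≡ true → Σℚ (λ a → unit a *ℚ v a j) ≡ 0ℚ
  v₀-vanishes j Ej = begin
    1ℚ *ℚ v zero j +ℚ Σℚ (λ b → 0ℚ *ℚ v (suc b) j)
      ≡⟨ cong (1ℚ *ℚ v zero j +ℚ_) (Σℚ-zero _ (λ b → ℚₚ.*-zeroˡ (v (suc b) j))) ⟩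
    1ℚ *ℚ v zero j +ℚ 0ℚ
      ≡⟨ trans (ℚₚ.+-identityʳ _) (ℚₚ.*-identityˡ _) ⟩
    v zero j
      ≡⟨ decidable-stable (v zero j ℚₚ.≟ 0ℚ) (λ v≢0 → no-pivot (j , Ej , v≢0)) ⟩
    0ℚ ∎
    where open ≡-Reasoning

InKernel : SignedGraph n → (Fin n → ℚ) → Set
InKernel Γ x = ∀ i → mulVec (adjMatrix Γ) x i ≡ 0ℚ

SupportedOn : List (Fin n) → (Fin n → ℚ) → Set
SupportedOn cs x = ∀ j → j ∉ cs → x j ≡ 0ℚ

IndependentColumns : SignedGraph n → List (Fin n) → Set
IndependentColumns Γ cs = ∀ x → SupportedOn cs x → InKernel Γ x → All (λ c → x c ≡ 0ℚ) cs

mulVec-combination : (M : Fin n → Fin n → ℚ) (c : Fin k → ℚ) (v : Fin k → Fin n → ℚ)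
  (i : Fin n) →
  mulVec M (λ j → Σℚ (λ a → c a *ℚ v a j)) i ≡ Σℚ (λ a → c a *ℚ mulVec M (v a) i)
mulVec-combination M c v i = begin
  Σℚ (λ j → M i j *ℚ Σℚ (λ a → c a *ℚ v a j))
    ≡⟨ Σℚ-cong (λ j → sym (Σℚ-*ˡ (M i j) (λ a → c a *ℚ v a j))) ⟩
  Σℚ (λ j → Σℚ (λ a → M i j *ℚ (c a *ℚ v a j)))
    ≡⟨ Σℚ-cong (λ j → Σℚ-cong (λ a → swap-scalar (M i j) (c a) (v a j))) ⟩
  Σℚ (λ j → Σℚ (λ a → c a *ℚ (M i j *ℚ v a j)))
    ≡⟨ Σℚ-comm (λ j a → c a *ℚ (M i j *ℚ v a j)) ⟩
  Σℚ (λ a → Σℚ (λ j → c a *ℚ (M i j *ℚ v a j)))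
    ≡⟨ Σℚ-cong (λ a → Σℚ-*ˡ (c a) (λ j → M i j *ℚ v a j)) ⟩
  Σℚ (λ a → c a *ℚ mulVec M (v a) i) ∎
  where
  open ≡-Reasoning
  swap-scalar : ∀ m γ x → m *ℚ (γ *ℚ x) ≡ γ *ℚ (m *ℚ x)
  swap-scalar m γ x = trans (sym (ℚₚ.*-assoc m γ x))
                            (trans (cong (_*ℚ x) (ℚₚ.*-comm m γ)) (ℚₚ.*-assoc γ m x))

fromList-false⇒∉ : {cs : List (Fin n)} {j : Fin n} → fromList cs j ≡ false → j ∉ cs
fromList-false⇒∉ eq j∈cs with () ← trans (sym eq) (∈⇒fromList j∈cs)

independentColumns⇒nullity : (Γ : SignedGraph n) {cs : List (Fin n)} → Unique cs →
                             IndependentColumns Γ cs → NullityAtMost Γ (n ∸ length cs)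
independentColumns⇒nullity {n} Γ {cs} unique independent k v kernel linIndep =
  ℕₚ.m+n≤o⇒m≤o∸n k (begin
    k + length cs           ≤⟨ ℕₚ.+-mono-≤ (independentOn⇒≤count (∁ D) v independentOn)
                                            (length≤count D unique (All.tabulate ∈⇒fromList)) ⟩
    count (∁ D) + count D   ≡⟨ ℕₚ.+-comm (count (∁ D)) (count D) ⟩
    count D + count (∁ D)   ≡⟨ count-∁ D ⟩
    n                       ∎)
  where
  open ℕₚ.≤-Reasoning
  D = fromList cs
  independentOn : IndependentOn (∁ D) v
  independentOn c vanish = linIndep c x≡0
    where
    x : Fin n → ℚ
    x j = Σℚ (λ a → c a *ℚ v a j)
    supported : SupportedOn cs x
    supported j j∉cs with D j in Dj
    ... | true  = contradiction (fromList⇒∈ Dj) j∉cs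
    ... | false = vanish j (cong not Dj)
    in-kernel : InKernel Γ x
    in-kernel i = trans (mulVec-combination (adjMatrix Γ) c v i)
      (Σℚ-zero _ (λ a → trans (cong (c a *ℚ_) (kernel a i)) (ℚₚ.*-zeroʳ (c a))))
    x≡0 : ∀ j → x j ≡ 0ℚ
    x≡0 j with D j in Dj
    ... | true  = All.lookup (independent x supported in-kernel) (fromList⇒∈ Dj)
    ... | false = supported j (fromList-false⇒∉ Dj)

sign : Bool → ℚ
sign b = if b then - 1ℚ else 1ℚ

sign≢0 : (b : Bool) → sign b ≢ 0ℚ
sign≢0 true  ()
sign≢0 false ()

sign-xor : (a b : Bool) → sign a *ℚ sign b ≡ sign (a xor b)
sign-xor true  true  = refl
sign-xor true  false = refl
sign-xor false true  = refl
sign-xor false false = refl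

sign-difference≢0 : (a b : Bool) → a xor b ≡ true → sign a - sign b ≢ 0ℚ
sign-difference≢0 true  false _ ()
sign-difference≢0 false true  _ ()

cramer : (a b c d : ℚ) {X Y : ℚ} → a *ℚ X +ℚ b *ℚ Y ≡ 0ℚ → c *ℚ X +ℚ d *ℚ Y ≡ 0ℚ →
         (a *ℚ d - b *ℚ c) *ℚ X ≡ 0ℚ × (a *ℚ d - b *ℚ c) *ℚ Y ≡ 0ℚ
cramer a b c d {X} {Y} e₁ e₂ =
  (begin
    (a *ℚ d - b *ℚ c) *ℚ X
      ≡⟨ solveX a b c d X Y ⟩
    d *ℚ (a *ℚ X +ℚ b *ℚ Y) - b *ℚ (c *ℚ X +ℚ d *ℚ Y)
      ≡⟨ cong₂ (λ s t → d *ℚ s - b *ℚ t) e₁ e₂ ⟩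
    d *ℚ 0ℚ - b *ℚ 0ℚ
      ≡⟨ annihilate d b ⟩
    0ℚ ∎) ,
  (begin
    (a *ℚ d - b *ℚ c) *ℚ Y
      ≡⟨ solveY a b c d X Y ⟩
    a *ℚ (c *ℚ X +ℚ d *ℚ Y) - c *ℚ (a *ℚ X +ℚ b *ℚ Y)
      ≡⟨ cong₂ (λ s t → a *ℚ s - c *ℚ t) e₂ e₁ ⟩
    a *ℚ 0ℚ - c *ℚ 0ℚ
      ≡⟨ annihilate a c ⟩
    0ℚ ∎)
  where
  open ≡-Reasoning
  open +-*-Solver
  solveX = solve 6 (λ a b c d X Y → (a :* d :- b :* c) :* X
                                 := d :* (a :* X :+ b :* Y) :- b :* (c :* X :+ d :* Y)) refl
  solveY = solve 6 (λ a b c d X Y → (a :* d :- b :* c) :* Y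
                                 := a :* (c :* X :+ d :* Y) :- c :* (a :* X :+ b :* Y)) refl
  annihilate = solve 2 (λ s t → s :* con 0ℚ :- t :* con 0ℚ := con 0ℚ) refl

-- Both unknowns vanish when the determinant ±1·±1 − ±1·±1 is ±2, i.e. when the product
-- of the four signs is −1.
signSystem-trivial : (s₁ s₂ s₃ s₄ : Bool) {X Y : ℚ} →
  sign s₁ *ℚ X +ℚ sign s₂ *ℚ Y ≡ 0ℚ → sign s₃ *ℚ X +ℚ sign s₄ *ℚ Y ≡ 0ℚ →
  (s₁ xor s₂) xor (s₃ xor s₄) ≡ true → X ≡ 0ℚ × Y ≡ 0ℚ
signSystem-trivial s₁ s₂ s₃ s₄ e₁ e₂ odd =
  let detX , detY = cramer (sign s₁) (sign s₂) (sign s₃) (sign s₄) e₁ e₂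
  in *-cancel-nonzeroˡ _ det≢0 detX , *-cancel-nonzeroˡ _ det≢0 detY
  where
  det≢0 : sign s₁ *ℚ sign s₄ - sign s₂ *ℚ sign s₃ ≢ 0ℚ
  det≢0 rewrite sign-xor s₁ s₄ | sign-xor s₂ s₃ =
    sign-difference≢0 (s₁ xor s₄) (s₂ xor s₃) (begin
      (s₁ xor s₄) xor (s₂ xor s₃) ≡⟨ xor-interchange s₁ s₄ s₂ s₃ ⟩
      (s₁ xor s₂) xor (s₄ xor s₃) ≡⟨ cong ((s₁ xor s₂) xor_) (Boolₚ.xor-comm s₄ s₃) ⟩
      (s₁ xor s₂) xor (s₃ xor s₄) ≡⟨ odd ⟩
      true                        ∎)
    where open ≡-Reasoning

module _ (Γ : SignedGraph n) where

  adjMatrix-edge : {r c : Fin n} → Adj Γ r c → adjMatrix Γ r c ≡ sign (neg Γ r c)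
  adjMatrix-edge rc rewrite rc = refl

  adjMatrix-term : {r j : Fin n} {x : ℚ} → (Adj Γ r j → x ≡ 0ℚ) →
                   adjMatrix Γ r j *ℚ x ≡ 0ℚ
  adjMatrix-term {r} {j} {x} x≡0 with adj Γ r j
  ... | false = ℚₚ.*-zeroˡ x
  ... | true  = trans (cong (sign (neg Γ r j) *ℚ_) (x≡0 refl)) (ℚₚ.*-zeroʳ (sign (neg Γ r j)))

  kernel-row-single : {x : Fin n → ℚ} → InKernel Γ x → {r c : Fin n} → Adj Γ r c →
    (∀ j → j ≢ c → Adj Γ r j → x j ≡ 0ℚ) → x c ≡ 0ℚ
  kernel-row-single {x} kernel {r} {c} rc others =
    *-cancel-nonzeroˡ (sign (neg Γ r c)) (sign≢0 (neg Γ r c)) (begin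
      sign (neg Γ r c) *ℚ x c   ≡⟨ cong (_*ℚ x c) (adjMatrix-edge rc) ⟨
      adjMatrix Γ r c *ℚ x c    ≡⟨ Σℚ-single _ c (λ j j≢c → adjMatrix-term (others j j≢c)) ⟨
      mulVec (adjMatrix Γ) x r  ≡⟨ kernel r ⟩
      0ℚ                        ∎)
    where open ≡-Reasoning

  kernel-row-pair : {x : Fin n → ℚ} → InKernel Γ x → {r c d : Fin n} → c ≢ d →
    Adj Γ r c → Adj Γ r d → (∀ j → j ≢ c → j ≢ d → Adj Γ r j → x j ≡ 0ℚ) →
    sign (neg Γ r c) *ℚ x c +ℚ sign (neg Γ r d) *ℚ x d ≡ 0ℚ
  kernel-row-pair {x} kernel {r} {c} {d} c≢d rc rd others = begin
    sign (neg Γ r c) *ℚ x c +ℚ sign (neg Γ r d) *ℚ x d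
      ≡⟨ cong₂ _+ℚ_ (cong (_*ℚ x c) (adjMatrix-edge rc))
                    (cong (_*ℚ x d) (adjMatrix-edge rd)) ⟨
    adjMatrix Γ r c *ℚ x c +ℚ adjMatrix Γ r d *ℚ x d
      ≡⟨ Σℚ-pair _ c d c≢d (λ j j≢c j≢d → adjMatrix-term (others j j≢c j≢d)) ⟨
    mulVec (adjMatrix Γ) x r
      ≡⟨ kernel r ⟩
    0ℚ ∎
    where open ≡-Reasoning

-- Rows rᵢ and columns cᵢ of A(Γ) forming a lower triangular submatrix with nonzero diagonal.
data Triangular (Γ : SignedGraph n) : List (Fin n × Fin n) → Set where
  []   : Triangular Γ []
  step : ∀ {r c ps} → Adj Γ r c → All (λ (_ , c′) → adj Γ r c′ ≡ false) ps →
         Triangular Γ ps → Triangular Γ ((r , c) ∷ ps)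

module _ {Γ : SignedGraph n} where

  triangular-unique : {ps : List (Fin n × Fin n)} → Triangular Γ ps → Unique (map proj₂ ps)
  triangular-unique []                  = []
  triangular-unique (step rc later tri) =
    Allₚ.map⁺ (All.map (λ r≁c′ → nonAdj-≢ Γ r≁c′ rc) later) ∷ triangular-unique tri

  triangular-independent : {ps : List (Fin n × Fin n)} → Triangular Γ ps →
                           IndependentColumns Γ (map proj₂ ps)
  triangular-independent []                                     x supported kernel = []
  triangular-independent (step {r} {c} {ps} rc later tri) x supported kernel =
    xc≡0 ∷ triangular-independent tri x supported′ kernel
    where
    later′ : All (λ c′ → adj Γ r c′ ≡ false) (map proj₂ ps)
    later′ = Allₚ.map⁺ later
    xc≡0 : x c ≡ 0ℚ
    xc≡0 = kernel-row-single Γ kernel rc λ j j≢c rj → supported j λ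
      { (here j≡c)    → j≢c j≡c
      ; (there j∈cs) → nonAdj-≢ Γ (All.lookup later′ j∈cs) rj refl }
    supported′ : SupportedOn (map proj₂ ps) x
    supported′ j j∉cs with j ≟ c
    ... | yes refl = xc≡0
    ... | no  j≢c  = supported j λ { (here j≡c) → j≢c j≡c ; (there j∈cs) → j∉cs j∈cs }

  triangular⇒nullity : {ps : List (Fin n × Fin n)} → Triangular Γ ps →
                       NullityAtMost Γ (n ∸ length ps)
  triangular⇒nullity {ps} tri = subst (λ m → NullityAtMost Γ (n ∸ m)) (Listₚ.length-map proj₂ ps)
    (independentColumns⇒nullity Γ (triangular-unique tri) (triangular-independent tri))

negativeSquare⇒nullity : (Γ : SignedGraph n) {u w a b : Fin n} → u ≢ w → a ≢ b →
  Adj Γ u a → Adj Γ u b → Adj Γ w a → Adj Γ w b →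
  adj Γ u w ≡ false → adj Γ a b ≡ false →
  (neg Γ u a xor neg Γ u b) xor (neg Γ w a xor neg Γ w b) ≡ true → NullityAtMost Γ (n ∸ 4)
negativeSquare⇒nullity Γ {u} {w} {a} {b} u≢w a≢b ua ub wa wb u≁w a≁b odd =
  independentColumns⇒nullity Γ {a ∷ b ∷ u ∷ w ∷ []}
    ((a≢b ∷ a≢u ∷ a≢w ∷ []) ∷ (b≢u ∷ b≢w ∷ []) ∷ (u≢w ∷ []) ∷ [] ∷ [])
    independent
  where
  a≢u = adj-irrefl Γ ua ∘ sym
  a≢w = adj-irrefl Γ wa ∘ sym
  b≢u = adj-irrefl Γ ub ∘ sym
  b≢w = adj-irrefl Γ wb ∘ sym
  odd′ : (neg Γ a u xor neg Γ a w) xor (neg Γ b u xor neg Γ b w) ≡ true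
  odd′ rewrite sym (neg-sym Γ u a ua) | sym (neg-sym Γ w a wa)
             | sym (neg-sym Γ u b ub) | sym (neg-sym Γ w b wb) =
    trans (xor-interchange (neg Γ u a) (neg Γ w a) (neg Γ u b) (neg Γ w b)) odd
  independent : IndependentColumns Γ (a ∷ b ∷ u ∷ w ∷ [])
  independent x supported kernel =
    proj₁ xab≡0 ∷ proj₂ xab≡0 ∷ proj₁ xuw≡0 ∷ proj₂ xuw≡0 ∷ []
    where
    outside : ∀ {j} → j ≢ a → j ≢ b → j ≢ u → j ≢ w → x j ≡ 0ℚ
    outside j≢a j≢b j≢u j≢w =
      supported _ (Allₚ.All¬⇒¬Any (j≢a ∷ j≢b ∷ j≢u ∷ j≢w ∷ []))
    row : ∀ {r c d} → c ≢ d → Adj Γ r c → Adj Γ r d →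
          (∀ {j} → Adj Γ r j → j ≢ c → j ≢ d → x j ≡ 0ℚ) →
          sign (neg Γ r c) *ℚ x c +ℚ sign (neg Γ r d) *ℚ x d ≡ 0ℚ
    row c≢d rc rd others =
      kernel-row-pair Γ kernel c≢d rc rd (λ j j≢c j≢d rj → others rj j≢c j≢d)
    row-u = row a≢b ua ub λ uj j≢a j≢b →
      outside j≢a j≢b (adj-irrefl Γ uj ∘ sym) (nonAdj-≢ Γ u≁w uj)
    row-w = row a≢b wa wb λ wj j≢a j≢b →
      outside j≢a j≢b (nonAdj-≢ Γ (nonAdj-sym Γ u≁w) wj) (adj-irrefl Γ wj ∘ sym)
    row-a = row u≢w (Adj-sym Γ ua) (Adj-sym Γ wa) λ aj j≢u j≢w →
      outside (adj-irrefl Γ aj ∘ sym) (nonAdj-≢ Γ a≁b aj) j≢u j≢w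
    row-b = row u≢w (Adj-sym Γ ub) (Adj-sym Γ wb) λ bj j≢u j≢w →
      outside (nonAdj-≢ Γ (nonAdj-sym Γ a≁b) bj) (adj-irrefl Γ bj ∘ sym) j≢u j≢w
    xab≡0 = signSystem-trivial (neg Γ u a) (neg Γ u b) (neg Γ w a) (neg Γ w b) row-u row-w odd
    xuw≡0 = signSystem-trivial (neg Γ a u) (neg Γ a w) (neg Γ b u) (neg Γ b w) row-a row-b odd′

module _ (Γ : SignedGraph n) {a b c d : Fin n} where

  inducedPath⇒nullity : Adj Γ a b → Adj Γ b c → Adj Γ c d →
    adj Γ a c ≡ false → adj Γ a d ≡ false → adj Γ b d ≡ false → NullityAtMost Γ (n ∸ 4)
  inducedPath⇒nullity ab bc cd a≁c a≁d b≁d = triangular⇒nullity {Γ = Γ}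
    (step ab (a≁c ∷ adj-irr Γ a ∷ a≁d ∷ [])
    (step (Adj-sym Γ cd) (nonAdj-sym Γ a≁d ∷ adj-irr Γ d ∷ [])
    (step (Adj-sym Γ ab) (b≁d ∷ [])
    (step cd [] []))))

  pendantEdge⇒nullity : Adj Γ a b → Adj Γ c d → adj Γ a c ≡ false → adj Γ a d ≡ false →
                        NullityAtMost Γ (n ∸ 4)
  pendantEdge⇒nullity ab cd a≁c a≁d = triangular⇒nullity {Γ = Γ}
    (step ab (a≁d ∷ a≁c ∷ adj-irr Γ a ∷ [])
    (step cd (adj-irr Γ c ∷ nonAdj-sym Γ a≁c ∷ [])
    (step (Adj-sym Γ cd) (nonAdj-sym Γ a≁d ∷ [])
    (step (Adj-sym Γ ab) [] []))))

lastOrInject₁ : (i : Fin (suc k)) → i ≡ fromℕ k ⊎ ∃ λ j → inject₁ j ≡ i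
lastOrInject₁ {zero}  zero    = inj₁ refl
lastOrInject₁ {suc k} zero    = inj₂ (zero , refl)
lastOrInject₁ {suc k} (suc i) with lastOrInject₁ i
... | inj₁ i≡last    = inj₁ (cong suc i≡last)
... | inj₂ (j , j≡i) = inj₂ (suc j , cong suc j≡i)

edge-ends⇒length≡1 : (i : Fin k) → ¬ Interior {k} (inject₁ i) → ¬ Interior {k} (suc i) →
                     k ≡ 1
edge-ends⇒length≡1 {suc zero}    zero    _    _    = refl
edge-ends⇒length≡1 {suc (suc k)} zero    _    ¬int = contradiction (s≤s z≤n , s≤s (s≤s z≤n)) ¬int
edge-ends⇒length≡1 {suc k}       (suc i) ¬int _    = contradiction
  (s≤s z≤n , s≤s (subst (_< k) (sym (Finₚ.toℕ-inject₁ i)) (Finₚ.toℕ<n i))) ¬int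

innerVertices : {Γ : SignedGraph n} {u w : Fin n} → Path Γ k u w → List (Fin n)
innerVertices {k = zero}  X = []
innerVertices {k = suc k} X = tabulate (λ (j : Fin k) → Path.vtx X (suc (inject₁ j)))

innerVertices-length : {Γ : SignedGraph n} {u w : Fin n} (X : Path Γ k u w) →
                       length (innerVertices X) ≡ k ∸ 1
innerVertices-length {k = zero}  X = refl
innerVertices-length {k = suc k} X = Listₚ.length-tabulate _

pathVertices-within : {Γ : SignedGraph n} {u w : Fin n} (X : Path Γ k u w) (S : Fin n → Bool) →
  S u ≡ true → S w ≡ true → All (λ x → S x ≡ true) (innerVertices X) →
  ∀ s → S (Path.vtx X s) ≡ true
pathVertices-within X S Su Sw S-inner zero = trans (cong S (Walk.start (Path.walk X))) Su
pathVertices-within {k = suc k} X S Su Sw S-inner (suc s) with lastOrInject₁ s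
... | inj₁ refl       = trans (cong S (Walk.end (Path.walk X))) Sw
... | inj₂ (j , refl) = All.lookup S-inner (∈ₚ.∈-tabulate⁺ j)

module _ {Γ : SignedGraph n} {u w : Fin n} (X : Path Γ k u w) where

  private
    v = Path.vtx X
    v-injective : ∀ {s t} → v s ≡ v t → s ≡ t
    v-injective = Path.inj X _ _

  along : (i : Fin k) → Adj Γ (v (inject₁ i)) (v (suc i))
  along = Walk.step (Path.walk X)

  vtx₀≢ : {y : Fin n} → y ≢ u → v zero ≢ y
  vtx₀≢ y≢u eq = y≢u (trans (sym eq) (Walk.start (Path.walk X)))

  vtx≢u : {s : Fin (suc k)} → s ≢ zero → v s ≢ u
  vtx≢u s≢0 eq = s≢0 (v-injective (trans eq (sym (Walk.start (Path.walk X)))))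

  pathEdges : List (Edge n)
  pathEdges = tabulate (λ (i : Fin k) → v (inject₁ i) , v (suc i))

  pathEdges-length : length pathEdges ≡ k
  pathEdges-length = Listₚ.length-tabulate _

  pathEdges-edges : All (IsEdge Γ) pathEdges
  pathEdges-edges = Allₚ.tabulate⁺ along

  pathEdges-within : (S : Fin n → Bool) → (∀ s → S (v s) ≡ true) → All (Within S) pathEdges
  pathEdges-within S onX = Allₚ.tabulate⁺ (λ i → onX (inject₁ i) , onX (suc i))

  pathEdges-distinct : AllPairs _≉ᴱ_ pathEdges
  pathEdges-distinct = AllPairsₚ.tabulate⁺ distinct
    where
    distinct : ∀ {i j} → i ≢ j → (v (inject₁ i) , v (suc i)) ≉ᴱ (v (inject₁ j) , v (suc j))
    distinct i≢j (inj₁ (same , _))         = i≢j (Finₚ.inject₁-injective (v-injective same))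
    distinct {i} {j} i≢j (inj₂ (ij′ , i′j)) =
      ℕₚ.<-asym (lt i j (v-injective ij′)) (lt j i (v-injective (sym i′j)))
      where
      lt : ∀ i j → inject₁ i ≡ suc j → toℕ j < toℕ i
      lt i j eq = ℕₚ.≤-reflexive (trans (cong toℕ (sym eq)) (Finₚ.toℕ-inject₁ i))

  offPath-not-pathEdgeˡ : {x y : Fin n} → (∀ s → v s ≢ x) → All ((x , y) ≉ᴱ_) pathEdges
  offPath-not-pathEdgeˡ off = Allₚ.tabulate⁺ λ
    { i (inj₁ (x≡ , _)) → off _ (sym x≡) ; i (inj₂ (x≡ , _)) → off _ (sym x≡) }

  offPath-not-pathEdgeʳ : {x y : Fin n} → (∀ s → v s ≢ y) → All ((x , y) ≉ᴱ_) pathEdges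
  offPath-not-pathEdgeʳ off = Allₚ.tabulate⁺ λ
    { i (inj₁ (_ , y≡)) → off _ (sym y≡) ; i (inj₂ (_ , y≡)) → off _ (sym y≡) }

  chord-not-pathEdge : (s t : Fin (suc k)) → toℕ t ≢ suc (toℕ s) → toℕ s ≢ suc (toℕ t) →
                       All ((v s , v t) ≉ᴱ_) pathEdges
  chord-not-pathEdge s t t≢s+1 s≢t+1 = Allₚ.tabulate⁺ not-edge
    where
    not-edge : ∀ i → (v s , v t) ≉ᴱ (v (inject₁ i) , v (suc i))
    not-edge i (inj₁ (s≡ , t≡)) with v-injective s≡ | v-injective t≡
    ... | refl | refl = t≢s+1 (cong suc (sym (Finₚ.toℕ-inject₁ i)))
    not-edge i (inj₂ (s≡ , t≡)) with v-injective s≡ | v-injective t≡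
    ... | refl | refl = s≢t+1 (cong suc (sym (Finₚ.toℕ-inject₁ i)))

  ends-not-pathEdge : k ≢ 1 → All ((u , w) ≉ᴱ_) pathEdges
  ends-not-pathEdge k≢1 = subst₂ (λ x y → All ((x , y) ≉ᴱ_) pathEdges)
    (Walk.start (Path.walk X)) (Walk.end (Path.walk X))
    (chord-not-pathEdge zero (fromℕ k) (k≢1 ∘ trans (sym (Finₚ.toℕ-fromℕ k))) λ ())

disjointPaths-distinctEdges : ∀ {a b} {Γ : SignedGraph n} {u w : Fin n}
  (X : Path Γ a u w) (Y : Path Γ b u w) → AvoidsP X Y → AvoidsP Y X → (a ≡ 1 → b ≢ 1) →
  All (λ e → All (e ≉ᴱ_) (pathEdges Y)) (pathEdges X)
disjointPaths-distinctEdges {a} {b} X Y X⊥Y Y⊥X atMostOne =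
  Allₚ.tabulate⁺ λ i → Allₚ.tabulate⁺ λ j → shared⇒both-length1 i j
  where
  shared⇒both-length1 : ∀ i j → (Path.vtx X (inject₁ i) , Path.vtx X (suc i)) ≉ᴱ
                                  (Path.vtx Y (inject₁ j) , Path.vtx Y (suc j))
  shared⇒both-length1 i j (inj₁ (e₁ , e₂)) = atMostOne
    (edge-ends⇒length≡1 i (λ int → X⊥Y _ _ int e₁) (λ int → X⊥Y _ _ int e₂))
    (edge-ends⇒length≡1 j (λ int → Y⊥X _ _ int (sym e₁)) (λ int → Y⊥X _ _ int (sym e₂)))
  shared⇒both-length1 i j (inj₂ (e₁ , e₂)) = atMostOne
    (edge-ends⇒length≡1 i (λ int → X⊥Y _ _ int e₁) (λ int → X⊥Y _ _ int e₂))
    (edge-ends⇒length≡1 j (λ int → Y⊥X _ _ int (sym e₂)) (λ int → Y⊥X _ _ int (sym e₁)))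

interior₁ : Interior {suc (suc k)} (suc zero)
interior₁ = s≤s z≤n , s≤s (s≤s z≤n)

interior₂ : Interior {suc (suc (suc k))} (suc (suc zero))
interior₂ = s≤s z≤n , s≤s (s≤s (s≤s z≤n))

avoids⇒off : ∀ {a b} {Γ : SignedGraph n} {u w : Fin n} (X : Path Γ a u w) (Y : Path Γ b u w) →
             AvoidsP X Y → ∀ {s} → Interior s → ∀ t → Path.vtx Y t ≢ Path.vtx X s
avoids⇒off X Y X⊥Y int t eq = X⊥Y _ t int (sym eq)

record Theta (Γ : SignedGraph n) (p q l : ℕ) : Set where
  field
    {u w}     : Fin n
    P         : Path Γ p u w
    Q         : Path Γ q u w
    R         : Path Γ l u w
    1≤p       : 1 ≤ p
    1≤q       : 1 ≤ q
    1≤l       : 1 ≤ l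
    atMostOne : AtMostOneIsOne p q l
    P⊥Q       : AvoidsP P Q
    Q⊥P       : AvoidsP Q P
    P⊥R       : AvoidsP P R
    R⊥P       : AvoidsP R P
    Q⊥R       : AvoidsP Q R
    R⊥Q       : AvoidsP R Q

theta : {Γ : SignedGraph n} → ContainsTheta Γ →
        Σ ℕ λ p → Σ ℕ λ q → Σ ℕ λ l → Theta Γ p q l
theta (p , q , l , u , w , P , Q , R , 1≤p , 1≤q , 1≤l , atMostOne ,
       P⊥Q , Q⊥P , P⊥R , R⊥P , Q⊥R , R⊥Q) =
  p , q , l , record
    { P = P ; Q = Q ; R = R ; 1≤p = 1≤p ; 1≤q = 1≤q ; 1≤l = 1≤l ; atMostOne = atMostOne
    ; P⊥Q = P⊥Q ; Q⊥P = Q⊥P ; P⊥R = P⊥R ; R⊥P = R⊥P ; Q⊥R = Q⊥R ; R⊥Q = R⊥Q }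

module _ {Γ : SignedGraph n} {p q l : ℕ} (θ : Theta Γ p q l) where
  open Theta θ

  swapPQ : Theta Γ q p l
  swapPQ = record
    { P = Q ; Q = P ; R = R ; 1≤p = 1≤q ; 1≤q = 1≤p ; 1≤l = 1≤l
    ; atMostOne = (λ q≡1 p≡1 → proj₁ atMostOne p≡1 q≡1) , proj₂ (proj₂ atMostOne)
                , proj₁ (proj₂ atMostOne)
    ; P⊥Q = Q⊥P ; Q⊥P = P⊥Q ; P⊥R = Q⊥R ; R⊥P = R⊥Q ; Q⊥R = P⊥R ; R⊥Q = R⊥P }

  swapQR : Theta Γ p l q
  swapQR = record
    { P = P ; Q = R ; R = Q ; 1≤p = 1≤p ; 1≤q = 1≤l ; 1≤l = 1≤q
    ; atMostOne = proj₁ (proj₂ atMostOne) , proj₁ atMostOne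
                , (λ l≡1 q≡1 → proj₂ (proj₂ atMostOne) q≡1 l≡1)
    ; P⊥Q = P⊥R ; Q⊥P = R⊥P ; P⊥R = P⊥Q ; R⊥P = Q⊥P ; Q⊥R = R⊥Q ; R⊥Q = Q⊥R }

module ThetaGraph {Γ : SignedGraph n} {p q l : ℕ} (θ : Theta Γ p q l) where
  open Theta θ public

  Pvertices : List (Fin n)
  Pvertices = tabulate (Path.vtx P)

  vertices : List (Fin n)
  vertices = Pvertices ++ innerVertices Q ++ innerVertices R

  Vθ : Fin n → Bool
  Vθ = fromList vertices

  Eθ : List (Edge n)
  Eθ = pathEdges P ++ pathEdges Q ++ pathEdges R

  onP : ∀ s → Vθ (Path.vtx P s) ≡ true
  onP s = ∈⇒fromList {cs = vertices} (∈ₚ.∈-++⁺ˡ (∈ₚ.∈-tabulate⁺ {f = Path.vtx P} s))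

  Vθu : Vθ u ≡ true
  Vθu = subst (λ x → Vθ x ≡ true) (Walk.start (Path.walk P)) (onP zero)

  Vθw : Vθ w ≡ true
  Vθw = subst (λ x → Vθ x ≡ true) (Walk.end (Path.walk P)) (onP (fromℕ p))

  onQ : ∀ s → Vθ (Path.vtx Q s) ≡ true
  onQ = pathVertices-within Q Vθ Vθu Vθw
    (All.tabulate λ x∈ →
      ∈⇒fromList {cs = vertices} (∈ₚ.∈-++⁺ʳ Pvertices (∈ₚ.∈-++⁺ˡ x∈)))

  onR : ∀ s → Vθ (Path.vtx R s) ≡ true
  onR = pathVertices-within R Vθ Vθu Vθw
    (All.tabulate λ x∈ →
      ∈⇒fromList {cs = vertices} (∈ₚ.∈-++⁺ʳ Pvertices (∈ₚ.∈-++⁺ʳ (innerVertices Q) x∈)))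

  Eθ-distinct : AllPairs _≉ᴱ_ Eθ
  Eθ-distinct = AllPairsₚ.++⁺ (pathEdges-distinct P)
    (AllPairsₚ.++⁺ (pathEdges-distinct Q) (pathEdges-distinct R)
                   (disjointPaths-distinctEdges Q R Q⊥R R⊥Q (proj₂ (proj₂ atMostOne))))
    (All.zipWith (λ (PQ , PR) → Allₚ.++⁺ PQ PR)
      (disjointPaths-distinctEdges P Q P⊥Q Q⊥P (proj₁ atMostOne) ,
       disjointPaths-distinctEdges P R P⊥R R⊥P (proj₁ (proj₂ atMostOne))))

  Eθ-edges : All (IsEdge Γ) Eθ
  Eθ-edges = Allₚ.++⁺ (pathEdges-edges P) (Allₚ.++⁺ (pathEdges-edges Q) (pathEdges-edges R))

  Eθ-within : All (Within Vθ) Eθ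
  Eθ-within = Allₚ.++⁺ (pathEdges-within P Vθ onP)
               (Allₚ.++⁺ (pathEdges-within Q Vθ onQ) (pathEdges-within R Vθ onR))

  Eθ-length : length Eθ ≡ p + (q + l)
  Eθ-length = trans (Listₚ.length-++ (pathEdges P))
    (cong₂ _+_ (pathEdges-length P)
      (trans (Listₚ.length-++ (pathEdges Q)) (cong₂ _+_ (pathEdges-length Q) (pathEdges-length R))))

  vertices-length : length vertices ≡ suc p + ((q ∸ 1) + (l ∸ 1))
  vertices-length = begin
    length vertices
      ≡⟨ Listₚ.length-++ Pvertices ⟩
    length Pvertices + length (innerVertices Q ++ innerVertices R)
      ≡⟨ cong₂ _+_ (Listₚ.length-tabulate (Path.vtx P))
                   (trans (Listₚ.length-++ (innerVertices Q))
                          (cong₂ _+_ (innerVertices-length Q) (innerVertices-length R))) ⟩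
    suc p + ((q ∸ 1) + (l ∸ 1)) ∎
    where open ≡-Reasoning

  -- u and w are listed once, as ends of P, so the theta has one vertex fewer than edges.
  Vθ-count : suc (count Vθ) ≤ length Eθ
  Vθ-count = begin
    suc (count Vθ)                     ≤⟨ s≤s (count-fromList≤ vertices) ⟩
    suc (length vertices)              ≡⟨ cong suc vertices-length ⟩
    suc (suc p + ((q ∸ 1) + (l ∸ 1)))  ≡⟨ arith 1≤q 1≤l ⟩
    p + (q + l)                        ≡⟨ Eθ-length ⟨
    length Eθ                          ∎
    where
    open ℕₚ.≤-Reasoning
    arith : ∀ {q l} → 1 ≤ q → 1 ≤ l → suc (suc p + ((q ∸ 1) + (l ∸ 1))) ≡ p + (q + l)
    arith {suc q} {suc l} _ _ = sym (trans (ℕₚ.+-suc p (q + suc l))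
      (cong suc (trans (cong (p +_) (ℕₚ.+-suc q l)) (ℕₚ.+-suc p (q + l)))))

  spanning⇒n<|Eθ| : (∀ z → Vθ z ≡ true) → suc n ≤ p + (q + l)
  spanning⇒n<|Eθ| spanning = subst₂ _≤_ (cong suc (count-full Vθ spanning)) Eθ-length Vθ-count

  module Chordless (bicyclic : Bicyclic Γ) =
    Tight bicyclic Vθ Vθu Eθ-distinct Eθ-edges Eθ-within Vθ-count

  notInEθ : {e : Edge n} → All (e ≉ᴱ_) (pathEdges P) → All (e ≉ᴱ_) (pathEdges Q) →
            All (e ≉ᴱ_) (pathEdges R) → All (e ≉ᴱ_) Eθ
  notInEθ eP eQ eR = Allₚ.++⁺ eP (Allₚ.++⁺ eQ eR)

-- P₂ P₁ u Q₁ is an induced path.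
longPath⇒nullity : {Γ : SignedGraph n} {p q l : ℕ} → Bicyclic Γ → Theta Γ (3 + p) (2 + q) l →
                   NullityAtMost Γ (n ∸ 4)
longPath⇒nullity {Γ = Γ} bicyclic θ =
  inducedPath⇒nullity Γ (Adj-sym Γ (along P (suc zero))) (Adj-sym Γ (along P zero)) P₀Q₁
    (noChord (onP _) (onP _) (notInEθ (chord-not-pathEdge P (suc (suc zero)) zero (λ ()) (λ ()))
                                        (offPath-not-pathEdgeˡ Q P₂∉Q) (offPath-not-pathEdgeˡ R P₂∉R)))
    (noChord (onP _) (onQ _) (notInEθ (offPath-not-pathEdgeʳ P Q₁∉P)
                                        (offPath-not-pathEdgeˡ Q P₂∉Q) (offPath-not-pathEdgeˡ R P₂∉R)))
    (noChord (onP _) (onQ _) (notInEθ (offPath-not-pathEdgeʳ P Q₁∉P)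
                                        (offPath-not-pathEdgeˡ Q P₁∉Q) (offPath-not-pathEdgeˡ R P₁∉R)))
  where
  open ThetaGraph θ
  open Chordless bicyclic
  P₀Q₁ : Adj Γ (Path.vtx P zero) (Path.vtx Q (suc zero))
  P₀Q₁ = subst (λ x → Adj Γ x (Path.vtx Q (suc zero)))
               (trans (Walk.start (Path.walk Q)) (sym (Walk.start (Path.walk P)))) (along Q zero)
  P₁∉Q = avoids⇒off P Q P⊥Q {suc zero} interior₁
  P₁∉R = avoids⇒off P R P⊥R {suc zero} interior₁
  P₂∉Q = avoids⇒off P Q P⊥Q {suc (suc zero)} interior₂
  P₂∉R = avoids⇒off P R P⊥R {suc (suc zero)} interior₂
  Q₁∉P = avoids⇒off Q P Q⊥P {suc zero} interior₁

record EdgeAvoiding (Γ : SignedGraph n) (S : Fin n → Bool) (y : Fin n) : Set where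
  constructor edgeAvoiding
  field
    {b₁ b₂}  : Fin n
    adjacent : Adj Γ b₁ b₂
    inside₁  : S b₁ ≡ true
    inside₂  : S b₂ ≡ true
    b₁≢y     : b₁ ≢ y
    b₂≢y     : b₂ ≢ y

firstSteps-distinct : {Γ : SignedGraph n} {p q l : ℕ} (θ : Theta Γ (suc p) (suc q) l) →
  Path.vtx (Theta.P θ) (suc zero) ≢ Path.vtx (Theta.Q θ) (suc zero)
firstSteps-distinct {p = suc p}            θ = Theta.P⊥Q θ (suc zero) (suc zero) interior₁
firstSteps-distinct {p = zero} {q = suc q} θ = Theta.Q⊥P θ (suc zero) (suc zero) interior₁ ∘ sym
firstSteps-distinct {p = zero} {q = zero}  θ = contradiction refl (proj₁ (Theta.atMostOne θ) refl)

-- An edge of the theta missing u: the second edge of a path of length at least 2.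
edgeAvoiding-u : {Γ : SignedGraph n} {p q l : ℕ} (θ : Theta Γ (suc p) (suc q) l) →
                 EdgeAvoiding Γ (ThetaGraph.Vθ θ) (Theta.u θ)
edgeAvoiding-u {p = suc p} θ =
  edgeAvoiding (along P (suc zero)) (onP (suc zero)) (onP (suc (suc zero))) (vtx≢u P λ ()) (vtx≢u P λ ())
  where open ThetaGraph θ
edgeAvoiding-u {p = zero} {q = suc q} θ =
  edgeAvoiding (along Q (suc zero)) (onQ (suc zero)) (onQ (suc (suc zero))) (vtx≢u Q λ ()) (vtx≢u Q λ ())
  where open ThetaGraph θ
edgeAvoiding-u {p = zero} {q = zero} θ = contradiction refl (proj₁ (Theta.atMostOne θ) refl)

-- An edge of the theta missing y ≠ u: the first edge of P or of Q.
edgeAvoiding-≢u : {Γ : SignedGraph n} {p q l : ℕ} (θ : Theta Γ (suc p) (suc q) l) {y : Fin n} →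
                  y ≢ Theta.u θ → EdgeAvoiding Γ (ThetaGraph.Vθ θ) y
edgeAvoiding-≢u θ {y} y≢u with y ≟ Path.vtx (Theta.P θ) (suc zero)
... | no  y≢P₁ = edgeAvoiding (along P zero) (onP zero) (onP (suc zero)) (vtx₀≢ P y≢u) (y≢P₁ ∘ sym)
  where open ThetaGraph θ
... | yes refl = edgeAvoiding (along Q zero) (onQ zero) (onQ (suc zero)) (vtx₀≢ Q y≢u)
                              (firstSteps-distinct θ ∘ sym)
  where open ThetaGraph θ

edgeAvoiding-any : {Γ : SignedGraph n} {p q l : ℕ} (θ : Theta Γ p q l) (y : Fin n) →
                   EdgeAvoiding Γ (ThetaGraph.Vθ θ) y
edgeAvoiding-any {p = zero}              θ y = contradiction (Theta.1≤p θ) λ ()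
edgeAvoiding-any {p = suc p} {q = zero}  θ y = contradiction (Theta.1≤q θ) λ ()
edgeAvoiding-any {p = suc p} {q = suc q} θ y with y ≟ Theta.u θ
... | yes refl = edgeAvoiding-u θ
... | no  y≢u  = edgeAvoiding-≢u θ y≢u

-- A vertex outside the theta yields an edge a y with a outside and y on the theta; a has no other
-- neighbour on the theta, so a y together with a theta edge missing y is a triangular pattern.
pendant⇒nullity : {Γ : SignedGraph n} {p q l : ℕ} → Bicyclic Γ → (θ : Theta Γ p q l) →
                  (z : Fin n) → ThetaGraph.Vθ θ z ≡ false → NullityAtMost Γ (n ∸ 4)
pendant⇒nullity {Γ = Γ} bicyclic θ z Vz =
  let a , y , ay , Va , Vy = exitEdge Vθ (proj₂ (proj₁ bicyclic z u)) Vz Vθu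
      open EdgeAvoiding (edgeAvoiding-any θ y)
  in pendantEdge⇒nullity Γ ay adjacent (noSecondNeighbour Va ay Vy inside₁ b₁≢y)
                                       (noSecondNeighbour Va ay Vy inside₂ b₂≢y)
  where
  open ThetaGraph θ
  open Chordless bicyclic

xor-step-mod2 : ∀ a b c m → m % 2 ≡ ind (b xor c) → (ind (a xor b) + m) % 2 ≡ ind (a xor c)
xor-step-mod2 a b c m m≡ = trans (%-distribˡ-+ (ind (a xor b)) m 2)
  (trans (cong (λ t → (ind (a xor b) % 2 + t) % 2) m≡) (cases a b c))
  where
  cases : ∀ a b c → (ind (a xor b) % 2 + ind (b xor c)) % 2 ≡ ind (a xor c)
  cases true  true  true  = refl
  cases true  true  false = refl
  cases true  false true  = refl
  cases true  false false = refl
  cases false true  true  = refl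
  cases false true  false = refl
  cases false false true  = refl
  cases false false false = refl

telescope-mod2 : (f : Fin (suc k) → Bool) →
  Σℕ (λ (i : Fin k) → ind (f (inject₁ i) xor f (suc i))) % 2 ≡ ind (f zero xor f (fromℕ k))
telescope-mod2 {zero}  f = cong ind (sym (Boolₚ.xor-same (f zero)))
telescope-mod2 {suc k} f = xor-step-mod2 (f zero) (f (suc zero)) (f (fromℕ (suc k))) _
                                         (telescope-mod2 (λ i → f (suc i)))

Switches : SignedGraph n → (Fin n → Bool) → Edge n → Set
Switches Γ σ (x , y) = neg Γ x y ≡ σ x xor σ y

switches-≈ᴱ : (Γ : SignedGraph n) (σ : Fin n → Bool) {e f : Edge n} → IsEdge Γ f → e ≈ᴱ f →
              Switches Γ σ f → Switches Γ σ e
switches-≈ᴱ Γ σ f-edge (inj₁ (refl , refl)) switched = switched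
switches-≈ᴱ Γ σ {f = x , y} f-edge (inj₂ (refl , refl)) switched =
  trans (sym (neg-sym Γ x y f-edge)) (trans switched (Boolₚ.xor-comm (σ x) (σ y)))

switching⇒¬unbalanced : (Γ : SignedGraph n) (σ : Fin n → Bool) →
  (∀ {x y} → Adj Γ x y → Switches Γ σ (x , y)) → ¬ Unbalanced Γ
switching⇒¬unbalanced Γ σ switched (k , C , odd) = contradiction (begin
  1
    ≡⟨ odd ⟨
  negCount C % 2
    ≡⟨ cong (_% 2) (Σℕ-cong (λ i → cong ind (switched (Cycle.step C i)))) ⟩
  Σℕ (λ i → ind (σ (v (inject₁ i)) xor σ (v (suc i)))) % 2
    ≡⟨ telescope-mod2 (σ ∘ v) ⟩
  ind (σ (v zero) xor σ (v (fromℕ k)))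
    ≡⟨ cong (λ t → ind (σ (v zero) xor σ t)) (Cycle.closed C) ⟨
  ind (σ (v zero) xor σ (v zero))
    ≡⟨ cong ind (Boolₚ.xor-same (σ (v zero))) ⟩
  0 ∎) λ ()
  where
  open ≡-Reasoning
  v = Cycle.vtx C

xor-cancel : ∀ x y → x xor y ≡ false → x ≡ y
xor-cancel true  true  _ = refl
xor-cancel false false _ = refl

square-closes : ∀ A B C D → (A xor B) xor (C xor D) ≡ false → D ≡ B xor (A xor C)
square-closes A B C D even = sym (xor-cancel (B xor (A xor C)) D (begin
  (B xor (A xor C)) xor D ≡⟨ cong (_xor D) (Boolₚ.xor-assoc B A C) ⟨
  ((B xor A) xor C) xor D ≡⟨ Boolₚ.xor-assoc (B xor A) C D ⟩
  (B xor A) xor (C xor D) ≡⟨ cong (_xor (C xor D)) (Boolₚ.xor-comm B A) ⟩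
  (A xor B) xor (C xor D) ≡⟨ even ⟩
  false                   ∎))
  where open ≡-Reasoning

module K₂,₃ {Γ : SignedGraph n} (bicyclic : Bicyclic Γ) (θ : Theta Γ 2 2 2) where
  open ThetaGraph θ
  open Chordless bicyclic

  middle : Path Γ 2 u w → Fin n
  middle X = Path.vtx X (suc zero)

  u-middle : (X : Path Γ 2 u w) → Adj Γ u (middle X)
  u-middle X = subst (λ x → Adj Γ x (middle X)) (Walk.start (Path.walk X)) (along X zero)

  middle-w : (X : Path Γ 2 u w) → Adj Γ (middle X) w
  middle-w X = subst (Adj Γ (middle X)) (Walk.end (Path.walk X)) (along X (suc zero))

  a : Fin n
  a = middle P

  u≢w : u ≢ w
  u≢w u≡w = vtx≢u P {suc (suc zero)} (λ ()) (trans (Walk.end (Path.walk P)) (sym u≡w))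

  u≁w : adj Γ u w ≡ false
  u≁w = noChord Vθu Vθw
    (notInEθ (ends-not-pathEdge P λ ()) (ends-not-pathEdge Q λ ()) (ends-not-pathEdge R λ ()))

  squareParity : Fin n → Bool
  squareParity x = (neg Γ u a xor neg Γ u x) xor (neg Γ w a xor neg Γ w x)

  negativeSquare : (Y : Path Γ 2 u w) → AvoidsP Y P → Vθ (middle Y) ≡ true →
                   squareParity (middle Y) ≡ true → NullityAtMost Γ (n ∸ 4)
  negativeSquare Y Y⊥P VY odd = negativeSquare⇒nullity Γ u≢w a≢Y
    (u-middle P) (u-middle Y) (Adj-sym Γ (middle-w P)) (Adj-sym Γ (middle-w Y)) u≁w
    (noChord (onP (suc zero)) VY (notInEθ (offPath-not-pathEdgeʳ P Y∉P)
                                         (offPath-not-pathEdgeˡ Q (avoids⇒off P Q P⊥Q interior₁))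
                                         (offPath-not-pathEdgeˡ R (avoids⇒off P R P⊥R interior₁))))
    odd
    where
    Y∉P = avoids⇒off Y P Y⊥P {suc zero} interior₁
    a≢Y : a ≢ middle Y
    a≢Y = Y∉P (suc zero)

  -- σ explains the signs on the path u P₁ w; a positive square u P₁ w x transfers this to u x w.
  σ : Fin n → Bool
  σ z = if does (z ≟ u) then false else if does (z ≟ w) then neg Γ u a xor neg Γ w a else neg Γ u z

  σ-u : σ u ≡ false
  σ-u rewrite dec-true (u ≟ u) refl = refl

  σ-w : σ w ≡ neg Γ u a xor neg Γ w a
  σ-w rewrite dec-false (w ≟ u) (u≢w ∘ sym) | dec-true (w ≟ w) refl = refl

  σ-middle : (X : Path Γ 2 u w) → σ (middle X) ≡ neg Γ u (middle X)
  σ-middle X rewrite dec-false (middle X ≟ u) (vtx≢u X λ ())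
                   | dec-false (middle X ≟ w) (adj-irrefl Γ (middle-w X)) = refl

  switches-path : (X : Path Γ 2 u w) → squareParity (middle X) ≡ false →
                  All (Switches Γ σ) (pathEdges X)
  switches-path X even = first ∷ second ∷ []
    where
    x = middle X
    first : Switches Γ σ (Path.vtx X zero , x)
    first = subst (λ z → Switches Γ σ (z , x)) (sym (Walk.start (Path.walk X)))
                  (sym (cong₂ _xor_ σ-u (σ-middle X)))
    second : Switches Γ σ (x , Path.vtx X (suc (suc zero)))
    second = subst (λ z → Switches Γ σ (x , z)) (sym (Walk.end (Path.walk X))) (begin
      neg Γ x w
        ≡⟨ neg-sym Γ x w (middle-w X) ⟩
      neg Γ w x
        ≡⟨ square-closes (neg Γ u a) (neg Γ u x) (neg Γ w a) (neg Γ w x) even ⟩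
      neg Γ u x xor (neg Γ u a xor neg Γ w a)
        ≡⟨ cong₂ _xor_ (σ-middle X) σ-w ⟨
      σ x xor σ w ∎)
      where open ≡-Reasoning

  balanced : (∀ z → Vθ z ≡ true) → squareParity (middle Q) ≡ false →
             squareParity (middle R) ≡ false → ¬ Unbalanced Γ
  balanced spanning even-Q even-R = switching⇒¬unbalanced Γ σ λ {x} {y} xy →
    let (f-switches , f-edge) , xy≈f = All.lookupAny (All.zip (Eθ-switches , Eθ-edges))
                                                     (edgeWithin⇒inT (spanning x) (spanning y) xy)
    in switches-≈ᴱ Γ σ f-edge xy≈f f-switches
    where
    Eθ-switches : All (Switches Γ σ) Eθ
    Eθ-switches = Allₚ.++⁺
      (switches-path P (cong₂ _xor_ (Boolₚ.xor-same (neg Γ u a)) (Boolₚ.xor-same (neg Γ w a))))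
      (Allₚ.++⁺ (switches-path Q even-Q) (switches-path R even-R))

  K₂,₃⇒nullity : (∀ z → Vθ z ≡ true) → Unbalanced Γ → NullityAtMost Γ (n ∸ 4)
  K₂,₃⇒nullity spanning unbalanced
    with squareParity (middle Q) in parity-Q | squareParity (middle R) in parity-R
  ... | true  | _     = negativeSquare Q Q⊥P (spanning (middle Q)) parity-Q
  ... | false | true  = negativeSquare R R⊥P (spanning (middle R)) parity-R
  ... | false | false = contradiction unbalanced (balanced spanning parity-Q parity-R)

forced-two : ∀ {a b c} → a ≤ 2 → b + c ≤ 4 → 6 ≤ a + (b + c) → a ≡ 2
forced-two {a} a≤2 b+c≤4 six =
  ℕₚ.≤-antisym a≤2 (ℕₚ.+-cancelʳ-≤ 4 2 a (ℕₚ.≤-trans six (ℕₚ.+-monoʳ-≤ a b+c≤4)))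

all-two : ∀ {p q l} → p ≤ 2 → q ≤ 2 → l ≤ 2 → 6 ≤ p + (q + l) → p ≡ 2 × q ≡ 2 × l ≡ 2
all-two {p} {q} {l} p≤2 q≤2 l≤2 six =
  forced-two {b = q} {c = l} p≤2 (ℕₚ.+-mono-≤ q≤2 l≤2) six ,
  forced-two {b = p} {c = l} q≤2 (ℕₚ.+-mono-≤ p≤2 l≤2)
    (subst (6 ≤_) (trans (sym (ℕₚ.+-assoc p q l))
                         (trans (cong (_+ l) (ℕₚ.+-comm p q)) (ℕₚ.+-assoc q p l))) six) ,
  forced-two {b = p} {c = q} l≤2 (ℕₚ.+-mono-≤ p≤2 q≤2)
    (subst (6 ≤_) (trans (sym (ℕₚ.+-assoc p q l)) (ℕₚ.+-comm (p + q) l)) six)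

spanningShortTheta⇒nullity : {Γ : SignedGraph n} {p q l : ℕ} → Bicyclic Γ → (θ : Theta Γ p q l) →
  p ≤ 2 → q ≤ 2 → l ≤ 2 → 5 ≤ n → (∀ z → ThetaGraph.Vθ θ z ≡ true) → Unbalanced Γ →
  NullityAtMost Γ (n ∸ 4)
spanningShortTheta⇒nullity bicyclic θ p≤2 q≤2 l≤2 5≤n spanning unbalanced
  with all-two p≤2 q≤2 l≤2 (ℕₚ.≤-trans (s≤s 5≤n) (ThetaGraph.spanning⇒n<|Eθ| θ spanning))
... | refl , refl , refl = K₂,₃.K₂,₃⇒nullity bicyclic θ spanning unbalanced

shortPaths⇒nullity : {Γ : SignedGraph n} {p q l : ℕ} → Bicyclic Γ → (θ : Theta Γ p q l) →
  p ≤ 2 → q ≤ 2 → l ≤ 2 → 5 ≤ n → Unbalanced Γ → NullityAtMost Γ (n ∸ 4)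
shortPaths⇒nullity bicyclic θ p≤2 q≤2 l≤2 5≤n unbalanced
  with Finₚ.any? (λ z → ThetaGraph.Vθ θ z Boolₚ.≟ false)
... | yes (z , Vz) = pendant⇒nullity bicyclic θ z Vz
... | no  none     = spanningShortTheta⇒nullity bicyclic θ p≤2 q≤2 l≤2 5≤n
                       (λ z → Boolₚ.¬-not λ Vz → none (z , Vz)) unbalanced

-- At most one path has length 1, so Q or R has length at least 2.
firstPathLong⇒nullity : {Γ : SignedGraph n} {p q l : ℕ} → Bicyclic Γ → Theta Γ p q l → 3 ≤ p →
                        NullityAtMost Γ (n ∸ 4)
firstPathLong⇒nullity {q = suc (suc q)}                 bicyclic θ (s≤s (s≤s (s≤s _))) =
  longPath⇒nullity bicyclic θ
firstPathLong⇒nullity {q = suc zero} {l = suc (suc l)} bicyclic θ (s≤s (s≤s (s≤s _))) =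
  longPath⇒nullity bicyclic (swapQR θ)
firstPathLong⇒nullity {q = suc zero} {l = suc zero}    bicyclic θ _ =
  contradiction refl (proj₂ (proj₂ (Theta.atMostOne θ)) refl)
firstPathLong⇒nullity {q = suc zero} {l = zero}        bicyclic θ _ = contradiction (Theta.1≤l θ) λ ()
firstPathLong⇒nullity {q = zero}                       bicyclic θ _ = contradiction (Theta.1≤q θ) λ ()

proposition5p1 : (n : ℕ) → 5 ≤ n → (Γ : SignedGraph n) →
    InThetaClass Γ → Unbalanced Γ → NullityAtMost Γ (n ∸ 4)
proposition5p1 n 5≤n Γ (bicyclic , containsTheta) unbalanced
  with theta containsTheta
... | p , q , l , θ with 3 ℕₚ.≤? p | 3 ℕₚ.≤? q | 3 ℕₚ.≤? l
... | yes 3≤p | _       | _       = firstPathLong⇒nullity bicyclic θ 3≤p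
... | no  _   | yes 3≤q | _       = firstPathLong⇒nullity bicyclic (swapPQ θ) 3≤q
... | no  _   | no  _   | yes 3≤l = firstPathLong⇒nullity bicyclic (swapPQ (swapQR θ)) 3≤l
... | no  3≰p | no  3≰q | no  3≰l =
  shortPaths⇒nullity bicyclic θ (≤2 3≰p) (≤2 3≰q) (≤2 3≰l) 5≤n unbalanced
  where
  ≤2 : ∀ {m} → ¬ 3 ≤ m → m ≤ 2
  ≤2 3≰m = ℕₚ.≤-pred (ℕₚ.≰⇒> 3≰m)
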